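{- In the calculus $\mathrm{CAU}^-_\sigma$, the rewriting relation $\to_\sigma \cup \to_\tau$ (acting on terms, trails and substitutions, closed under all contexts) is terminating and confluent.
   Context: The calculus $\mathrm{CAU}^-_\sigma$ (untyped Calculus of Audited Units with explicit substitutions) uses nameless (de Bruijn) syntax with three mutually defined categories: Terms $M,N ::= 1 \mid \lambda.M \mid M\,N \mid \mathsf{let}(M,N) \mid !_q M \mid q \triangleright M \mid \iota(\vartheta) \mid M[s] \mid \mathrm{er}(M)$; Trails $q,q' ::= \mathsf{r} \mid \mathsf{t}(q,q') \mid \mathsf{ba} \mid \mathsf{bb} \mid \mathsf{ti} \mid \mathsf{lam}(q) \mid \mathsf{app}(q,q') \mid \mathsf{let}(q,q') \mid \mathsf{tr}(\zeta) \mid \mathrm{tl}(M)$; Substitutions $s,t ::= \langle\rangle \mid {\uparrow} \mid M\cdot s \mid s\circ t$. Here $1$ is the first de Bruijn index; $\lambda$ binds index 1 of its body; $\mathsf{let}(M,N)$ binds index 1 in $N$; $\vartheta=\{M_1,\dots,M_9\}$ is a family of nine terms indexed by the nine trail constructors in the order $\mathsf{r},\mathsf{t},\mathsf{ba},\mathsf{bb},\mathsf{ti},\mathsf{lam},\mathsf{app},\mathsf{let},\mathsf{tr}$, and $\zeta=\{q_1,\dots,q_9\}$ is likewise a family of nine trails. $!_qM$ is an audited unit with history $q$, $q\triangleright M$ a term annotated with a local trail, $\iota(\vartheta)$ a trail inspection, $M[s]$ an explicit substitution, $\mathrm{er}(M)$ explicit trail erasure, $\mathrm{tl}(M)$ explicit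 trail extraction; $\langle\rangle$ is the identity substitution, ${\uparrow}$ the shift, $\cdot$ cons, $\circ$ composition. ${\uparrow}^n$ denotes ${\uparrow}\circ\cdots\circ{\uparrow}$ ($n$ times), and $1[{\uparrow}^n]$ represents index $n+1$. $\sigma$-rules: $1[\langle\rangle]\to 1$; $1[M\cdot s]\to M$; $(\lambda.M)[s]\to \lambda.(M[1\cdot(s\circ{\uparrow})])$; $(M\,N)[s]\to M[s]\,N[s]$; $(!_qM)[s]\to !_q(M[s])$; $\mathsf{let}(M,N)[s]\to\mathsf{let}(M[s],N[1\cdot(s\circ{\uparrow})])$; $(q\triangleright M)[s]\to q\triangleright(M[s])$; $\iota(\{M_1,\dots,M_9\})[s]\to\iota(\{M_1[s],\dots,M_9[s]\})$; $M[s][t]\to M[s\circ t]$; $\langle\rangle\circ s\to s$; ${\uparrow}\circ\langle\rangle\to{\uparrow}$; ${\uparrow}\circ(M\cdot s)\to s$; $(M\cdot s)\circ t\to M[t]\cdot(s\circ t)$; $(s_1\circ s_2)\circ s_3\to s_1\circ(s_2\circ s_3)$; $\mathrm{er}(1)\to 1$; $\mathrm{er}(1[{\uparrow}^n])\to 1[{\uparrow}^n]$; $\mathrm{er}(\lambda.M)\to\lambda.\mathrm{er}(M)$; $\mathrm{er}(M\,N)\to\mathrm{er}(M)\,\mathrm{er}(N)$; $\mathrm{er}(!_qM)\to !_qM$; $\mathrm{er}(\mathsf{let}(M,N))\to\mathsf{let}(\mathrm{er}(M),\mathrm{er}(N))$; $\mathrm{er}(q\triangleright M)\to\mathrm{er}(M)$;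 $\mathrm{er}(\iota(\{M_i\}))\to\iota(\{\mathrm{er}(M_i)\})$; $\mathrm{tl}(1)\to\mathsf{r}$; $\mathrm{tl}(1[{\uparrow}^n])\to\mathsf{r}$; $\mathrm{tl}(\lambda.M)\to\mathsf{lam}(\mathrm{tl}(M))$; $\mathrm{tl}(M\,N)\to\mathsf{app}(\mathrm{tl}(M),\mathrm{tl}(N))$; $\mathrm{tl}(!_qM)\to\mathsf{r}$; $\mathrm{tl}(\mathsf{let}(M,N))\to\mathsf{let}(\mathrm{tl}(M),\mathrm{tl}(N))$; $\mathrm{tl}(q\triangleright M)\to\mathsf{t}(q,\mathrm{tl}(M))$; $\mathrm{tl}(\iota(\{M_i\}))\to\mathsf{tr}(\{\mathrm{tl}(M_i)\})$. $\tau$-rules: $\mathsf{r}\triangleright M\to M$; $q\triangleright(q'\triangleright M)\to\mathsf{t}(q,q')\triangleright M$; $!_q(q'\triangleright M)\to !_{\mathsf{t}(q,q')}M$; $\lambda.(q\triangleright M)\to\mathsf{lam}(q)\triangleright\lambda.M$; $(q\triangleright M)\,N\to\mathsf{app}(q,\mathsf{r})\triangleright M\,N$; $M\,(q\triangleright N)\to\mathsf{app}(\mathsf{r},q)\triangleright M\,N$; $\mathsf{let}(q\triangleright M,N)\to\mathsf{let}(q,\mathsf{r})\triangleright\mathsf{let}(M,N)$; $\mathsf{let}(M,q\triangleright N)\to\mathsf{let}(\mathsf{r},q)\triangleright\mathsf{let}(M,N)$; $\iota(\{M_1,\dots,q\triangleright M_i,\dots,M_9\})\to\mathsf{tr}(\{\mathsf{r},\dots,q,\dots,\mathsf{r}\})\triangleright\iota(\{M_1,\dots,M_9\})$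 ($q$ in position $i$); $\mathsf{t}(q,\mathsf{r})\to q$; $\mathsf{t}(\mathsf{r},q)\to q$; $\mathsf{tr}(\{\mathsf{r},\dots,\mathsf{r}\})\to\mathsf{r}$; $\mathsf{app}(\mathsf{r},\mathsf{r})\to\mathsf{r}$; $\mathsf{lam}(\mathsf{r})\to\mathsf{r}$; $\mathsf{let}(\mathsf{r},\mathsf{r})\to\mathsf{r}$; $\mathsf{t}(\mathsf{t}(q_1,q_2),q_3)\to\mathsf{t}(q_1,\mathsf{t}(q_2,q_3))$; $\mathsf{t}(\mathsf{lam}(q),\mathsf{lam}(q'))\to\mathsf{lam}(\mathsf{t}(q,q'))$; $\mathsf{t}(\mathsf{lam}(q_1),\mathsf{t}(\mathsf{lam}(q_1'),q))\to\mathsf{t}(\mathsf{lam}(\mathsf{t}(q_1,q_1')),q)$; $\mathsf{t}(\mathsf{app}(q_1,q_2),\mathsf{app}(q_1',q_2'))\to\mathsf{app}(\mathsf{t}(q_1,q_1'),\mathsf{t}(q_2,q_2'))$; $\mathsf{t}(\mathsf{app}(q_1,q_2),\mathsf{t}(\mathsf{app}(q_1',q_2'),q))\to\mathsf{t}(\mathsf{app}(\mathsf{t}(q_1,q_1'),\mathsf{t}(q_2,q_2')),q)$; the same two rules with $\mathsf{let}$ in place of $\mathsf{app}$; $\mathsf{t}(\mathsf{tr}(\{q_i\}),\mathsf{tr}(\{q_i'\}))\to\mathsf{tr}(\{\mathsf{t}(q_i,q_i')\})$; $\mathsf{t}(\mathsf{tr}(\{q_i\}),\mathsf{t}(\mathsf{tr}(\{q_i'\}),q))\to\mathsf{t}(\mathsf{tr}(\{\mathsf{t}(q_i,q_i')\}),q)$.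 Both $\sigma$- and $\tau$-rules may be applied to any subterm, subtrail or subsubstitution. -}

module Defs where

open import Data.Nat using (ℕ; zero; suc)
open import Data.Fin using (Fin)
open import Data.Vec using (Vec; lookup; map; replicate; zipWith; _[_]≔_; _∷_)
open import Relation.Binary.PropositionalEquality using (_≡_)

-- Syntax of CAU⁻_σ (nameless / de Bruijn), three mutually defined sorts.
-- Families ϑ, ζ of nine components are vectors of length 9, indexed in the
-- order r, t, ba, bb, ti, lam, app, let, tr.

data Term  : Set
data Trail : Set
data Subst : Set

infixl 8 _[_]
infixr 6 _▷_
infixr 5 _∷ₛ_
infixr 7 _∘ₛ_

data Term where
  one   : Term                          -- de Bruijn index 1
  lam   : Term → Term
  app   : Term → Term → Term
  letₘ  : Term → Term → Term
  bang  : Trail → Term → Term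
  _▷_   : Trail → Term → Term
  ins   : Vec Term 9 → Term
  _[_]  : Term → Subst → Term
  er    : Term → Term

data Trail where
  r    : Trail
  t    : Trail → Trail → Trail
  ba   : Trail
  bb   : Trail
  ti   : Trail
  lamT : Trail → Trail
  appT : Trail → Trail → Trail
  letT : Trail → Trail → Trail
  trT  : Vec Trail 9 → Trail
  tl   : Term → Trail

data Subst where
  idₛ    : Subst
  ↑      : Subst
  _∷ₛ_   : Term → Subst → Subst
  _∘ₛ_   : Subst → Subst → Subst

-- ups n = ↑^(n+1) = ↑ ∘ (↑ ∘ ( ... ∘ ↑)), i.e. n+1 shifts, so that
-- one [ ups n ] represents the index n+2.
ups : ℕ → Subst
ups zero    = ↑
ups (suc n) = ↑ ∘ₛ ups n

infix 4 _⟶ₘ_ _⟶ₜ_ _⟶ₛ_ _⟶ₘᵛ_ _⟶ₜᵛ_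

data _⟶ₘ_ : Term → Term → Set
data _⟶ₜ_ : Trail → Trail → Set
data _⟶ₛ_ : Subst → Subst → Set
data _⟶ₘᵛ_ : {n : ℕ} → Vec Term n → Vec Term n → Set
data _⟶ₜᵛ_ : {n : ℕ} → Vec Trail n → Vec Trail n → Set

data _⟶ₘ_ where
  σ-id     : one [ idₛ ] ⟶ₘ one
  σ-cons   : ∀ {M s} → one [ M ∷ₛ s ] ⟶ₘ M
  σ-lam    : ∀ {M s} → lam M [ s ] ⟶ₘ lam (M [ one ∷ₛ (s ∘ₛ ↑) ])
  σ-app    : ∀ {M N s} → app M N [ s ] ⟶ₘ app (M [ s ]) (N [ s ])
  σ-bang   : ∀ {q M s} → bang q M [ s ] ⟶ₘ bang q (M [ s ])
  σ-let    : ∀ {M N s} → letₘ M N [ s ] ⟶ₘ letₘ (M [ s ]) (N [ one ∷ₛ (s ∘ₛ ↑) ])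
  σ-tr     : ∀ {q M s} → (q ▷ M) [ s ] ⟶ₘ q ▷ (M [ s ])
  σ-ins    : ∀ {ϑ s} → ins ϑ [ s ] ⟶ₘ ins (map (_[ s ]) ϑ)
  σ-clos   : ∀ {M s s'} → M [ s ] [ s' ] ⟶ₘ M [ s ∘ₛ s' ]
  σ-er1    : er one ⟶ₘ one
  σ-erups  : ∀ {n} → er (one [ ups n ]) ⟶ₘ one [ ups n ]
  σ-erlam  : ∀ {M} → er (lam M) ⟶ₘ lam (er M)
  σ-erapp  : ∀ {M N} → er (app M N) ⟶ₘ app (er M) (er N)
  σ-erbang : ∀ {q M} → er (bang q M) ⟶ₘ bang q M
  σ-erlet  : ∀ {M N} → er (letₘ M N) ⟶ₘ letₘ (er M) (er N)
  σ-ertr   : ∀ {q M} → er (q ▷ M) ⟶ₘ er M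
  σ-erins  : ∀ {ϑ} → er (ins ϑ) ⟶ₘ ins (map er ϑ)
  τ-r      : ∀ {M} → r ▷ M ⟶ₘ M
  τ-tt     : ∀ {q q' M} → q ▷ (q' ▷ M) ⟶ₘ t q q' ▷ M
  τ-bang   : ∀ {q q' M} → bang q (q' ▷ M) ⟶ₘ bang (t q q') M
  τ-lam    : ∀ {q M} → lam (q ▷ M) ⟶ₘ lamT q ▷ lam M
  τ-appL   : ∀ {q M N} → app (q ▷ M) N ⟶ₘ appT q r ▷ app M N
  τ-appR   : ∀ {q M N} → app M (q ▷ N) ⟶ₘ appT r q ▷ app M N
  τ-letL   : ∀ {q M N} → letₘ (q ▷ M) N ⟶ₘ letT q r ▷ letₘ M N
  τ-letR   : ∀ {q M N} → letₘ M (q ▷ N) ⟶ₘ letT r q ▷ letₘ M N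
  τ-ins    : ∀ {ϑ q M} (i : Fin 9) → lookup ϑ i ≡ q ▷ M →
             ins ϑ ⟶ₘ trT (replicate 9 r [ i ]≔ q) ▷ ins (ϑ [ i ]≔ M)
  c-lam    : ∀ {M M'} → M ⟶ₘ M' → lam M ⟶ₘ lam M'
  c-appL   : ∀ {M M' N} → M ⟶ₘ M' → app M N ⟶ₘ app M' N
  c-appR   : ∀ {M N N'} → N ⟶ₘ N' → app M N ⟶ₘ app M N'
  c-letL   : ∀ {M M' N} → M ⟶ₘ M' → letₘ M N ⟶ₘ letₘ M' N
  c-letR   : ∀ {M N N'} → N ⟶ₘ N' → letₘ M N ⟶ₘ letₘ M N'
  c-bangQ  : ∀ {q q' M} → q ⟶ₜ q' → bang q M ⟶ₘ bang q' M
  c-bangM  : ∀ {q M M'} → M ⟶ₘ M' → bang q M ⟶ₘ bang q M'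
  c-trQ    : ∀ {q q' M} → q ⟶ₜ q' → q ▷ M ⟶ₘ q' ▷ M
  c-trM    : ∀ {q M M'} → M ⟶ₘ M' → q ▷ M ⟶ₘ q ▷ M'
  c-ins    : ∀ {ϑ ϑ'} → ϑ ⟶ₘᵛ ϑ' → ins ϑ ⟶ₘ ins ϑ'
  c-clM    : ∀ {M M' s} → M ⟶ₘ M' → M [ s ] ⟶ₘ M' [ s ]
  c-clS    : ∀ {M s s'} → s ⟶ₛ s' → M [ s ] ⟶ₘ M [ s' ]
  c-er     : ∀ {M M'} → M ⟶ₘ M' → er M ⟶ₘ er M'

data _⟶ₜ_ where
  σ-tl1    : tl one ⟶ₜ r
  σ-tlups  : ∀ {n} → tl (one [ ups n ]) ⟶ₜ r
  σ-tllam  : ∀ {M} → tl (lam M) ⟶ₜ lamT (tl M)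
  σ-tlapp  : ∀ {M N} → tl (app M N) ⟶ₜ appT (tl M) (tl N)
  σ-tlbang : ∀ {q M} → tl (bang q M) ⟶ₜ r
  σ-tllet  : ∀ {M N} → tl (letₘ M N) ⟶ₜ letT (tl M) (tl N)
  σ-tltr   : ∀ {q M} → tl (q ▷ M) ⟶ₜ t q (tl M)
  σ-tlins  : ∀ {ϑ} → tl (ins ϑ) ⟶ₜ trT (map tl ϑ)
  τ-tr     : ∀ {q} → t q r ⟶ₜ q
  τ-rt     : ∀ {q} → t r q ⟶ₜ q
  τ-trr    : trT (replicate 9 r) ⟶ₜ r
  τ-apprr  : appT r r ⟶ₜ r
  τ-lamr   : lamT r ⟶ₜ r
  τ-letrr  : letT r r ⟶ₜ r
  τ-assoc  : ∀ {q₁ q₂ q₃} → t (t q₁ q₂) q₃ ⟶ₜ t q₁ (t q₂ q₃)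
  τ-lamlam : ∀ {q q'} → t (lamT q) (lamT q') ⟶ₜ lamT (t q q')
  τ-lamlam' : ∀ {q₁ q₁' q} → t (lamT q₁) (t (lamT q₁') q) ⟶ₜ t (lamT (t q₁ q₁')) q
  τ-appapp : ∀ {q₁ q₂ q₁' q₂'} →
             t (appT q₁ q₂) (appT q₁' q₂') ⟶ₜ appT (t q₁ q₁') (t q₂ q₂')
  τ-appapp' : ∀ {q₁ q₂ q₁' q₂' q} →
             t (appT q₁ q₂) (t (appT q₁' q₂') q) ⟶ₜ t (appT (t q₁ q₁') (t q₂ q₂')) q
  τ-letlet : ∀ {q₁ q₂ q₁' q₂'} →
             t (letT q₁ q₂) (letT q₁' q₂') ⟶ₜ letT (t q₁ q₁') (t q₂ q₂')
  τ-letlet' : ∀ {q₁ q₂ q₁' q₂' q} →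
             t (letT q₁ q₂) (t (letT q₁' q₂') q) ⟶ₜ t (letT (t q₁ q₁') (t q₂ q₂')) q
  τ-trtr   : ∀ {ζ ζ'} → t (trT ζ) (trT ζ') ⟶ₜ trT (zipWith t ζ ζ')
  τ-trtr'  : ∀ {ζ ζ' q} → t (trT ζ) (t (trT ζ') q) ⟶ₜ t (trT (zipWith t ζ ζ')) q
  c-tL     : ∀ {q q' p} → q ⟶ₜ q' → t q p ⟶ₜ t q' p
  c-tR     : ∀ {q p p'} → p ⟶ₜ p' → t q p ⟶ₜ t q p'
  c-lamT   : ∀ {q q'} → q ⟶ₜ q' → lamT q ⟶ₜ lamT q'
  c-appTL  : ∀ {q q' p} → q ⟶ₜ q' → appT q p ⟶ₜ appT q' p
  c-appTR  : ∀ {q p p'} → p ⟶ₜ p' → appT q p ⟶ₜ appT q p'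
  c-letTL  : ∀ {q q' p} → q ⟶ₜ q' → letT q p ⟶ₜ letT q' p
  c-letTR  : ∀ {q p p'} → p ⟶ₜ p' → letT q p ⟶ₜ letT q p'
  c-trT    : ∀ {ζ ζ'} → ζ ⟶ₜᵛ ζ' → trT ζ ⟶ₜ trT ζ'
  c-tl     : ∀ {M M'} → M ⟶ₘ M' → tl M ⟶ₜ tl M'

data _⟶ₛ_ where
  σ-idl    : ∀ {s} → idₛ ∘ₛ s ⟶ₛ s
  σ-shid   : ↑ ∘ₛ idₛ ⟶ₛ ↑
  σ-shcons : ∀ {M s} → ↑ ∘ₛ (M ∷ₛ s) ⟶ₛ s
  σ-map    : ∀ {M s s'} → (M ∷ₛ s) ∘ₛ s' ⟶ₛ (M [ s' ]) ∷ₛ (s ∘ₛ s')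
  σ-assoc  : ∀ {s₁ s₂ s₃} → (s₁ ∘ₛ s₂) ∘ₛ s₃ ⟶ₛ s₁ ∘ₛ (s₂ ∘ₛ s₃)
  c-consM  : ∀ {M M' s} → M ⟶ₘ M' → M ∷ₛ s ⟶ₛ M' ∷ₛ s
  c-consS  : ∀ {M s s'} → s ⟶ₛ s' → M ∷ₛ s ⟶ₛ M ∷ₛ s'
  c-compL  : ∀ {s s' u} → s ⟶ₛ s' → s ∘ₛ u ⟶ₛ s' ∘ₛ u
  c-compR  : ∀ {s u u'} → u ⟶ₛ u' → s ∘ₛ u ⟶ₛ s ∘ₛ u'

data _⟶ₘᵛ_ where
  here  : ∀ {n M M'} {ϑ : Vec Term n} → M ⟶ₘ M' → (M ∷ ϑ) ⟶ₘᵛ (M' ∷ ϑ)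
  there : ∀ {n M} {ϑ ϑ' : Vec Term n} → ϑ ⟶ₘᵛ ϑ' → (M ∷ ϑ) ⟶ₘᵛ (M ∷ ϑ')

data _⟶ₜᵛ_ where
  here  : ∀ {n q q'} {ζ : Vec Trail n} → q ⟶ₜ q' → (q ∷ ζ) ⟶ₜᵛ (q' ∷ ζ)
  there : ∀ {n q} {ζ ζ' : Vec Trail n} → ζ ⟶ₜᵛ ζ' → (q ∷ ζ) ⟶ₜᵛ (q ∷ ζ')

-- Termination.  An expression is strongly normalising iff it is accessible
-- for "is a reduct or an immediate subexpression of", because a step inside
-- a subexpression lifts to a step of the whole.  So it suffices that every
-- constructor preserves accessibility, which is shown by induction on the
-- accessibility of its arguments.  Two constructors need an outer measure:
-- the rules fusing trail compositions t lower a weight that no step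
-- increases, and σ-lam, σ-let create the composition s ∘ ↑ whose rank, a
-- count of pending binders that no step increases, is below that of the
-- closure they act on.
--
-- Confluence.  All critical pairs are joinable, and Newman's lemma applies.

module Submission where

open import Defs
open import Data.Nat using (ℕ; zero; suc; _+_; _*_; _≤_; _<_; s≤s; z≤n; _⊔_)
open import Data.Nat.Properties
open import Data.Nat.Induction using (<-wellFounded)
open import Data.Nat.Tactic.RingSolver using (solve-∀)
open import Data.Fin using (Fin; zero; suc) renaming (_≟_ to _≟ᶠ_)
open import Data.Vec using (Vec; []; _∷_; lookup; map; replicate; zipWith; _[_]≔_)
open import Data.Vec.Properties
  using (lookup-map; map-∘; lookup-zipWith; lookup∘update; lookup∘update′; []≔-idempotent; []≔-commutes; map-[]≔)
open import Data.Product using (∃; _×_; _,_; -,_)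
open import Data.Empty using (⊥-elim)
open import Data.Vec.Relation.Unary.All using (All; []; _∷_)
open import Data.Vec.Relation.Unary.All.Properties using (lookup⁺; lookup⁻)
open import Function using (flip; _on_)
open import Induction.WellFounded using (Acc; acc; module Subrelation)
open import Relation.Binary.Construct.On using (accessible)
open import Relation.Nullary using (¬_; yes; no)
open import Relation.Binary.PropositionalEquality using (_≡_; refl; sym; trans; cong; cong₂; subst)
open import Relation.Binary.Construct.Closure.ReflexiveTransitive using (Star; ε; _◅_; _◅◅_; gmap)
import Relation.Binary.Construct.Closure.Transitive as ⁺
open import Relation.Binary.Rewriting using (StronglyNormalizing; Confluent; WeaklyConfluent; sn&wcr⇒cr)

data Expr : Set where
  term  : Term → Expr
  trail : Trail → Expr
  subs  : Subst → Expr

infix 4 _⟶_ _◁_ _≺_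

data _⟶_ : Expr → Expr → Set where
  stepₘ : ∀ {M N} → M ⟶ₘ N → term M ⟶ term N
  stepₜ : ∀ {q p} → q ⟶ₜ p → trail q ⟶ trail p
  stepₛ : ∀ {s u} → s ⟶ₛ u → subs s ⟶ subs u

data _◁_ : Expr → Expr → Set where
  lam◁   : ∀ {M} → term M ◁ term (lam M)
  appL◁  : ∀ {M N} → term M ◁ term (app M N)
  appR◁  : ∀ {M N} → term N ◁ term (app M N)
  letL◁  : ∀ {M N} → term M ◁ term (letₘ M N)
  letR◁  : ∀ {M N} → term N ◁ term (letₘ M N)
  bangQ◁ : ∀ {q M} → trail q ◁ term (bang q M)
  bangM◁ : ∀ {q M} → term M ◁ term (bang q M)
  trQ◁   : ∀ {q M} → trail q ◁ term (q ▷ M)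
  trM◁   : ∀ {q M} → term M ◁ term (q ▷ M)
  ins◁   : ∀ {ϑ} (i : Fin 9) → term (lookup ϑ i) ◁ term (ins ϑ)
  clM◁   : ∀ {M s} → term M ◁ term (M [ s ])
  clS◁   : ∀ {M s} → subs s ◁ term (M [ s ])
  er◁    : ∀ {M} → term M ◁ term (er M)
  tL◁    : ∀ {q p} → trail q ◁ trail (t q p)
  tR◁    : ∀ {q p} → trail p ◁ trail (t q p)
  lamT◁  : ∀ {q} → trail q ◁ trail (lamT q)
  appTL◁ : ∀ {q p} → trail q ◁ trail (appT q p)
  appTR◁ : ∀ {q p} → trail p ◁ trail (appT q p)
  letTL◁ : ∀ {q p} → trail q ◁ trail (letT q p)
  letTR◁ : ∀ {q p} → trail p ◁ trail (letT q p)
  trT◁   : ∀ {ζ} (i : Fin 9) → trail (lookup ζ i) ◁ trail (trT ζ)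
  tl◁    : ∀ {M} → term M ◁ trail (tl M)
  consM◁ : ∀ {M s} → term M ◁ subs (M ∷ₛ s)
  consS◁ : ∀ {M s} → subs s ◁ subs (M ∷ₛ s)
  compL◁ : ∀ {s u} → subs s ◁ subs (s ∘ₛ u)
  compR◁ : ∀ {s u} → subs u ◁ subs (s ∘ₛ u)

data _≺_ : Expr → Expr → Set where
  red : ∀ {x y} → x ⟶ y → y ≺ x
  sub : ∀ {x y} → y ◁ x → y ≺ x

SN : Expr → Set
SN = Acc (flip _⟶_)

Accₘ : Term → Set
Accₘ M = Acc _≺_ (term M)

Accₜ : Trail → Set
Accₜ q = Acc _≺_ (trail q)

Accₛ : Subst → Set
Accₛ s = Acc _≺_ (subs s)

⟶ₘᵛ-at : ∀ {n} {ϑ : Vec Term n} {M} (i : Fin n) → lookup ϑ i ⟶ₘ M → ϑ ⟶ₘᵛ (ϑ [ i ]≔ M)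
⟶ₘᵛ-at {ϑ = _ ∷ _} zero    st = here st
⟶ₘᵛ-at {ϑ = _ ∷ _} (suc i) st = there (⟶ₘᵛ-at i st)

⟶ₜᵛ-at : ∀ {n} {ζ : Vec Trail n} {q} (i : Fin n) → lookup ζ i ⟶ₜ q → ζ ⟶ₜᵛ (ζ [ i ]≔ q)
⟶ₜᵛ-at {ζ = _ ∷ _} zero    st = here st
⟶ₜᵛ-at {ζ = _ ∷ _} (suc i) st = there (⟶ₜᵛ-at i st)

⟶ₘᵛ-position : ∀ {n} {ϑ ϑ' : Vec Term n} → ϑ ⟶ₘᵛ ϑ' →
               ∃ λ i → ∃ λ M → (lookup ϑ i ⟶ₘ M) × (ϑ' ≡ ϑ [ i ]≔ M)
⟶ₘᵛ-position (here st) = zero , _ , st , refl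
⟶ₘᵛ-position (there st) with ⟶ₘᵛ-position st
... | i , M , st' , refl = suc i , M , st' , refl

◁-lift-step : ∀ {x y y'} → y ◁ x → y ⟶ y' → ∃ λ x' → (x ⟶ x') × (y' ◁ x')
◁-lift-step lam◁ (stepₘ st) = _ , stepₘ (c-lam st) , lam◁
◁-lift-step appL◁ (stepₘ st) = _ , stepₘ (c-appL st) , appL◁
◁-lift-step appR◁ (stepₘ st) = _ , stepₘ (c-appR st) , appR◁
◁-lift-step letL◁ (stepₘ st) = _ , stepₘ (c-letL st) , letL◁
◁-lift-step letR◁ (stepₘ st) = _ , stepₘ (c-letR st) , letR◁
◁-lift-step bangQ◁ (stepₜ st) = _ , stepₘ (c-bangQ st) , bangQ◁
◁-lift-step bangM◁ (stepₘ st) = _ , stepₘ (c-bangM st) , bangM◁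
◁-lift-step trQ◁ (stepₜ st) = _ , stepₘ (c-trQ st) , trQ◁
◁-lift-step trM◁ (stepₘ st) = _ , stepₘ (c-trM st) , trM◁
◁-lift-step {term (ins ϑ)} (ins◁ i) (stepₘ {N = M} st) =
  _ , stepₘ (c-ins (⟶ₘᵛ-at i st)) , subst (λ N → term N ◁ term (ins (ϑ [ i ]≔ M))) (lookup∘update i ϑ M) (ins◁ i)
◁-lift-step clM◁ (stepₘ st) = _ , stepₘ (c-clM st) , clM◁
◁-lift-step clS◁ (stepₛ st) = _ , stepₘ (c-clS st) , clS◁
◁-lift-step er◁ (stepₘ st) = _ , stepₘ (c-er st) , er◁
◁-lift-step tL◁ (stepₜ st) = _ , stepₜ (c-tL st) , tL◁
◁-lift-step tR◁ (stepₜ st) = _ , stepₜ (c-tR st) , tR◁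
◁-lift-step lamT◁ (stepₜ st) = _ , stepₜ (c-lamT st) , lamT◁
◁-lift-step appTL◁ (stepₜ st) = _ , stepₜ (c-appTL st) , appTL◁
◁-lift-step appTR◁ (stepₜ st) = _ , stepₜ (c-appTR st) , appTR◁
◁-lift-step letTL◁ (stepₜ st) = _ , stepₜ (c-letTL st) , letTL◁
◁-lift-step letTR◁ (stepₜ st) = _ , stepₜ (c-letTR st) , letTR◁
◁-lift-step {trail (trT ζ)} (trT◁ i) (stepₜ {p = q} st) =
  _ , stepₜ (c-trT (⟶ₜᵛ-at i st)) , subst (λ p → trail p ◁ trail (trT (ζ [ i ]≔ q))) (lookup∘update i ζ q) (trT◁ i)
◁-lift-step tl◁ (stepₘ st) = _ , stepₜ (c-tl st) , tl◁
◁-lift-step consM◁ (stepₘ st) = _ , stepₛ (c-consM st) , consM◁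
◁-lift-step consS◁ (stepₛ st) = _ , stepₛ (c-consS st) , consS◁
◁-lift-step compL◁ (stepₛ st) = _ , stepₛ (c-compL st) , compL◁
◁-lift-step compR◁ (stepₛ st) = _ , stepₛ (c-compR st) , compR◁

◁*-lift-step : ∀ {x y y'} → Star _◁_ y x → y ⟶ y' → ∃ λ x' → (x ⟶ x') × Star _◁_ y' x'
◁*-lift-step ε st = _ , st , ε
◁*-lift-step (y◁z ◅ z◁*x) st with ◁-lift-step y◁z st
... | _ , st' , y'◁z' with ◁*-lift-step z◁*x st'
...   | x' , st'' , z'◁*x' = x' , st'' , y'◁z' ◅ z'◁*x'

sizeₘ : Term → ℕ
sizeₜ : Trail → ℕ
sizeₛ : Subst → ℕ
sizeₘᵛ : ∀ {n} → Vec Term n → ℕ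
sizeₜᵛ : ∀ {n} → Vec Trail n → ℕ
sizeₘ one = 1
sizeₘ (lam M) = suc (sizeₘ M)
sizeₘ (app M N) = suc (sizeₘ M + sizeₘ N)
sizeₘ (letₘ M N) = suc (sizeₘ M + sizeₘ N)
sizeₘ (bang q M) = suc (sizeₜ q + sizeₘ M)
sizeₘ (q ▷ M) = suc (sizeₜ q + sizeₘ M)
sizeₘ (ins ϑ) = suc (sizeₘᵛ ϑ)
sizeₘ (M [ s ]) = suc (sizeₘ M + sizeₛ s)
sizeₘ (er M) = suc (sizeₘ M)
sizeₜ r = 1
sizeₜ (t q p) = suc (sizeₜ q + sizeₜ p)
sizeₜ ba = 1
sizeₜ bb = 1
sizeₜ ti = 1
sizeₜ (lamT q) = suc (sizeₜ q)
sizeₜ (appT q p) = suc (sizeₜ q + sizeₜ p)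
sizeₜ (letT q p) = suc (sizeₜ q + sizeₜ p)
sizeₜ (trT ζ) = suc (sizeₜᵛ ζ)
sizeₜ (tl M) = suc (sizeₘ M)
sizeₛ idₛ = 1
sizeₛ ↑ = 1
sizeₛ (M ∷ₛ s) = suc (sizeₘ M + sizeₛ s)
sizeₛ (s ∘ₛ u) = suc (sizeₛ s + sizeₛ u)
sizeₘᵛ [] = 0
sizeₘᵛ (M ∷ ϑ) = sizeₘ M + sizeₘᵛ ϑ
sizeₜᵛ [] = 0
sizeₜᵛ (q ∷ ζ) = sizeₜ q + sizeₜᵛ ζ

size : Expr → ℕ
size (term M) = sizeₘ M
size (trail q) = sizeₜ q
size (subs s) = sizeₛ s

sizeₘ-lookup : ∀ {n} (ϑ : Vec Term n) i → sizeₘ (lookup ϑ i) ≤ sizeₘᵛ ϑ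
sizeₘ-lookup (M ∷ ϑ) zero = m≤m+n _ _
sizeₘ-lookup (M ∷ ϑ) (suc i) = ≤-trans (sizeₘ-lookup ϑ i) (m≤n+m _ _)

sizeₜ-lookup : ∀ {n} (ζ : Vec Trail n) i → sizeₜ (lookup ζ i) ≤ sizeₜᵛ ζ
sizeₜ-lookup (q ∷ ζ) zero = m≤m+n _ _
sizeₜ-lookup (q ∷ ζ) (suc i) = ≤-trans (sizeₜ-lookup ζ i) (m≤n+m _ _)

size-◁ : ∀ {x y} → y ◁ x → size y < size x
size-◁ lam◁ = ≤-refl
size-◁ (appL◁ {M} {N}) = s≤s (m≤m+n (sizeₘ M) (sizeₘ N))
size-◁ (appR◁ {M} {N}) = s≤s (m≤n+m (sizeₘ N) (sizeₘ M))
size-◁ (letL◁ {M} {N}) = s≤s (m≤m+n (sizeₘ M) (sizeₘ N))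
size-◁ (letR◁ {M} {N}) = s≤s (m≤n+m (sizeₘ N) (sizeₘ M))
size-◁ (bangQ◁ {q} {M}) = s≤s (m≤m+n (sizeₜ q) (sizeₘ M))
size-◁ (bangM◁ {q} {M}) = s≤s (m≤n+m (sizeₘ M) (sizeₜ q))
size-◁ (trQ◁ {q} {M}) = s≤s (m≤m+n (sizeₜ q) (sizeₘ M))
size-◁ (trM◁ {q} {M}) = s≤s (m≤n+m (sizeₘ M) (sizeₜ q))
size-◁ (ins◁ {ϑ} i) = s≤s (sizeₘ-lookup ϑ i)
size-◁ (clM◁ {M} {s}) = s≤s (m≤m+n (sizeₘ M) (sizeₛ s))
size-◁ (clS◁ {M} {s}) = s≤s (m≤n+m (sizeₛ s) (sizeₘ M))
size-◁ er◁ = ≤-refl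
size-◁ (tL◁ {q} {p}) = s≤s (m≤m+n (sizeₜ q) (sizeₜ p))
size-◁ (tR◁ {q} {p}) = s≤s (m≤n+m (sizeₜ p) (sizeₜ q))
size-◁ lamT◁ = ≤-refl
size-◁ (appTL◁ {q} {p}) = s≤s (m≤m+n (sizeₜ q) (sizeₜ p))
size-◁ (appTR◁ {q} {p}) = s≤s (m≤n+m (sizeₜ p) (sizeₜ q))
size-◁ (letTL◁ {q} {p}) = s≤s (m≤m+n (sizeₜ q) (sizeₜ p))
size-◁ (letTR◁ {q} {p}) = s≤s (m≤n+m (sizeₜ p) (sizeₜ q))
size-◁ (trT◁ {ζ} i) = s≤s (sizeₜ-lookup ζ i)
size-◁ tl◁ = ≤-refl
size-◁ (consM◁ {M} {s}) = s≤s (m≤m+n (sizeₘ M) (sizeₛ s))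
size-◁ (consS◁ {M} {s}) = s≤s (m≤n+m (sizeₛ s) (sizeₘ M))
size-◁ (compL◁ {s} {u}) = s≤s (m≤m+n (sizeₛ s) (sizeₛ u))
size-◁ (compR◁ {s} {u}) = s≤s (m≤n+m (sizeₛ u) (sizeₛ s))

-- A step of a subexpression lifts to a step of the whole, and chains of
-- subexpressions are bounded by size.
sn⇒acc-below : ∀ {x} → SN x → ∀ {y} → Star _◁_ y x → Acc _≺_ y
sn⇒acc-below {x} (acc f) = go (<-wellFounded _)
  where
  go : ∀ {y} → Acc _<_ (size y) → Star _◁_ y x → Acc _≺_ y
  go (acc rs) y◁*x = acc λ
    { (red st) → let (_ , st' , y'◁*x') = ◁*-lift-step y◁*x st in sn⇒acc-below (f st') y'◁*x'
    ; (sub z◁y) → go (rs (size-◁ z◁y)) (z◁y ◅ y◁*x) }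

sn⇒acc : ∀ {x} → SN x → Acc _≺_ x
sn⇒acc s = sn⇒acc-below s ε

acc⇒sn : ∀ {x} → Acc _≺_ x → SN x
acc⇒sn (acc rs) = acc λ st → acc⇒sn (rs (red st))

acc-by-reducts : ∀ {x} → (∀ {y} → x ⟶ y → Acc _≺_ y) → Acc _≺_ x
acc-by-reducts f = sn⇒acc (acc λ st → acc⇒sn (f st))

acc-normal : ∀ {x} → (∀ {y} → ¬ x ⟶ y) → Acc _≺_ x
acc-normal nf = acc-by-reducts λ st → ⊥-elim (nf st)

data Somewhere {A : Set} (_<_ : A → A → Set) : ∀ {n} → Vec A n → Vec A n → Set where
  here  : ∀ {n x x'} {v : Vec A n} → x' < x → Somewhere _<_ (x' ∷ v) (x ∷ v)
  there : ∀ {n x} {v v' : Vec A n} → Somewhere _<_ v' v → Somewhere _<_ (x ∷ v') (x ∷ v)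

module _ {A : Set} {_<_ : A → A → Set} where

  acc-∷ : ∀ {n x} {v : Vec A n} → Acc _<_ x → Acc (Somewhere _<_) v → Acc (Somewhere _<_) (x ∷ v)
  acc-∷ ax@(acc rx) av@(acc rv) = acc λ
    { (here x'<x) → acc-∷ (rx x'<x) av
    ; (there v'<v) → acc-∷ ax (rv v'<v) }

  acc-somewhere : ∀ {n} (v : Vec A n) → (∀ i → Acc _<_ (lookup v i)) → Acc (Somewhere _<_) v
  acc-somewhere [] _ = acc λ ()
  acc-somewhere (x ∷ v) f = acc-∷ (f zero) (acc-somewhere v (λ i → f (suc i)))

  somewhere-update : ∀ {n} {v : Vec A n} i {x} → x < lookup v i → Somewhere _<_ (v [ i ]≔ x) v
  somewhere-update {v = _ ∷ _} zero x<vᵢ = here x<vᵢ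
  somewhere-update {v = _ ∷ _} (suc i) x<vᵢ = there (somewhere-update i x<vᵢ)

_≺ₘᵛ_ : ∀ {n} → Vec Term n → Vec Term n → Set
_≺ₘᵛ_ = Somewhere (_≺_ on term)

_≺ₜᵛ_ : ∀ {n} → Vec Trail n → Vec Trail n → Set
_≺ₜᵛ_ = Somewhere (_≺_ on trail)

⟶ₘᵛ⇒≺ₘᵛ : ∀ {n} {ϑ ϑ' : Vec Term n} → ϑ ⟶ₘᵛ ϑ' → ϑ' ≺ₘᵛ ϑ
⟶ₘᵛ⇒≺ₘᵛ (here st) = here (red (stepₘ st))
⟶ₘᵛ⇒≺ₘᵛ (there st) = there (⟶ₘᵛ⇒≺ₘᵛ st)

⟶ₜᵛ⇒≺ₜᵛ : ∀ {n} {ζ ζ' : Vec Trail n} → ζ ⟶ₜᵛ ζ' → ζ' ≺ₜᵛ ζ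
⟶ₜᵛ⇒≺ₜᵛ (here st) = here (red (stepₜ st))
⟶ₜᵛ⇒≺ₜᵛ (there st) = there (⟶ₜᵛ⇒≺ₜᵛ st)

-- The coefficients 2, 3 and 10 pay for the trail constructor created when a
-- τ-rule pulls a trail out of a λ, an application or let, or an inspection;
-- a bang absorbs trails into its history, so it weighs a constant.
wₘ : Term → ℕ
wₛ : Subst → ℕ
wₜ : Trail → ℕ
wₘᵛ : ∀ {n} → Vec Term n → ℕ
wₜᵛ : ∀ {n} → Vec Trail n → ℕ
wₘ one = 1
wₘ (lam M) = 2 * wₘ M
wₘ (app M N) = 3 * (wₘ M + wₘ N)
wₘ (letₘ M N) = 3 * (wₘ M + wₘ N)
wₘ (bang q M) = 1
wₘ (q ▷ M) = wₜ q + wₘ M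
wₘ (ins ϑ) = suc (10 * wₘᵛ ϑ)
wₘ (M [ s ]) = wₘ M * wₛ s
wₘ (er M) = wₘ M
wₛ idₛ = 1
wₛ ↑ = 1
wₛ (M ∷ₛ s) = wₘ M ⊔ wₛ s
wₛ (s ∘ₛ u) = wₛ s * wₛ u
wₜ r = 1
wₜ (t q p) = wₜ q + wₜ p
wₜ ba = 1
wₜ bb = 1
wₜ ti = 1
wₜ (lamT q) = wₜ q + 1
wₜ (appT q p) = wₜ q + wₜ p + 1
wₜ (letT q p) = wₜ q + wₜ p + 1
wₜ (trT ζ) = wₜᵛ ζ + 1
wₜ (tl M) = wₘ M
wₘᵛ [] = 0
wₘᵛ (M ∷ ϑ) = wₘ M + wₘᵛ ϑ
wₜᵛ [] = 0
wₜᵛ (q ∷ ζ) = wₜ q + wₜᵛ ζ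

1≤wₘ : ∀ M → 1 ≤ wₘ M
1≤wₛ : ∀ s → 1 ≤ wₛ s
1≤wₜ : ∀ q → 1 ≤ wₜ q
1≤wₘ one = ≤-refl
1≤wₘ (lam M) = ≤-trans (1≤wₘ M) (m≤m+n _ _)
1≤wₘ (app M N) = ≤-trans (≤-trans (1≤wₘ M) (m≤m+n _ _)) (m≤m+n _ _)
1≤wₘ (letₘ M N) = ≤-trans (≤-trans (1≤wₘ M) (m≤m+n _ _)) (m≤m+n _ _)
1≤wₘ (bang q M) = ≤-refl
1≤wₘ (q ▷ M) = ≤-trans (1≤wₜ q) (m≤m+n _ _)
1≤wₘ (ins ϑ) = s≤s z≤n
1≤wₘ (M [ s ]) = *-mono-≤ (1≤wₘ M) (1≤wₛ s)
1≤wₘ (er M) = 1≤wₘ M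
1≤wₛ idₛ = ≤-refl
1≤wₛ ↑ = ≤-refl
1≤wₛ (M ∷ₛ s) = ≤-trans (1≤wₘ M) (m≤m⊔n _ _)
1≤wₛ (s ∘ₛ u) = *-mono-≤ (1≤wₛ s) (1≤wₛ u)
1≤wₜ r = ≤-refl
1≤wₜ (t q p) = ≤-trans (1≤wₜ q) (m≤m+n _ _)
1≤wₜ ba = ≤-refl
1≤wₜ bb = ≤-refl
1≤wₜ ti = ≤-refl
1≤wₜ (lamT q) = m≤n+m _ _
1≤wₜ (appT q p) = m≤n+m _ _
1≤wₜ (letT q p) = m≤n+m _ _
1≤wₜ (trT ζ) = m≤n+m _ _
1≤wₜ (tl M) = 1≤wₘ M

wₘᵛ-map-[] : ∀ {n} (ϑ : Vec Term n) s → wₘᵛ (map (_[ s ]) ϑ) ≡ wₘᵛ ϑ * wₛ s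
wₘᵛ-map-[] [] s = refl
wₘᵛ-map-[] (M ∷ ϑ) s = trans (cong (wₘ M * wₛ s +_) (wₘᵛ-map-[] ϑ s)) (sym (*-distribʳ-+ (wₛ s) (wₘ M) (wₘᵛ ϑ)))

wₘᵛ-map-er : ∀ {n} (ϑ : Vec Term n) → wₘᵛ (map er ϑ) ≡ wₘᵛ ϑ
wₘᵛ-map-er [] = refl
wₘᵛ-map-er (M ∷ ϑ) = cong (wₘ M +_) (wₘᵛ-map-er ϑ)

wₜᵛ-map-tl : ∀ {n} (ϑ : Vec Term n) → wₜᵛ (map tl ϑ) ≡ wₘᵛ ϑ
wₜᵛ-map-tl [] = refl
wₜᵛ-map-tl (M ∷ ϑ) = cong (wₘ M +_) (wₜᵛ-map-tl ϑ)

wₜᵛ-zipWith-t : ∀ {n} (ζ ζ' : Vec Trail n) → wₜᵛ (zipWith t ζ ζ') ≡ wₜᵛ ζ + wₜᵛ ζ'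
wₜᵛ-zipWith-t [] [] = refl
wₜᵛ-zipWith-t (q ∷ ζ) (q' ∷ ζ') =
  trans (cong (wₜ q + wₜ q' +_) (wₜᵛ-zipWith-t ζ ζ')) (interchange (wₜ q) (wₜ q') (wₜᵛ ζ) (wₜᵛ ζ'))
  where
  interchange : ∀ a b c d → a + b + (c + d) ≡ a + c + (b + d)
  interchange = solve-∀

wₘᵛ-update : ∀ {n} (ϑ : Vec Term n) i M → wₘᵛ (ϑ [ i ]≔ M) + wₘ (lookup ϑ i) ≡ wₘᵛ ϑ + wₘ M
wₘᵛ-update (N ∷ ϑ) zero M = rearrange (wₘ M) (wₘᵛ ϑ) (wₘ N)
  where
  rearrange : ∀ a b c → a + b + c ≡ c + b + a
  rearrange = solve-∀
wₘᵛ-update (N ∷ ϑ) (suc i) M =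
  trans (+-assoc (wₘ N) _ _) (trans (cong (wₘ N +_) (wₘᵛ-update ϑ i M)) (sym (+-assoc (wₘ N) _ _)))

wₜᵛ-replicate-r : ∀ n → wₜᵛ (replicate n r) ≡ n
wₜᵛ-replicate-r zero = refl
wₜᵛ-replicate-r (suc n) = cong suc (wₜᵛ-replicate-r n)

wₜᵛ-replicate-r-update : ∀ n (i : Fin (suc n)) q → wₜᵛ (replicate (suc n) r [ i ]≔ q) ≡ n + wₜ q
wₜᵛ-replicate-r-update n zero q = trans (cong (wₜ q +_) (wₜᵛ-replicate-r n)) (+-comm (wₜ q) n)
wₜᵛ-replicate-r-update (suc n) (suc i) q = cong suc (wₜᵛ-replicate-r-update n i q)

private
  m≤m*n⁺ : ∀ m n → 1 ≤ n → m ≤ m * n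
  m≤m*n⁺ m n 1≤n = ≤-trans (≤-reflexive (sym (*-identityʳ m))) (*-monoʳ-≤ m 1≤n)

  1⊔n*1≡n : ∀ n → 1 ≤ n → 1 ⊔ (n * 1) ≡ n
  1⊔n*1≡n n 1≤n = trans (cong (1 ⊔_) (*-identityʳ n)) (m≤n⇒m⊔n≡n 1≤n)

  3*-distribʳ : ∀ a b c → 3 * (a * c + b * c) ≡ (3 * (a + b)) * c
  3*-distribʳ = solve-∀

  n+1≤2*n : ∀ a → 1 ≤ a → a + 1 ≤ 2 * a
  n+1≤2*n a 1≤a = ≤-trans (+-monoʳ-≤ a 1≤a) (≤-reflexive (cong (a +_) (sym (+-identityʳ a))))

  n+m+1≤3*[n+m] : ∀ a b → 1 ≤ a → a + b + 1 ≤ 3 * (a + b)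
  n+m+1≤3*[n+m] a b 1≤a =
    ≤-trans (+-monoʳ-≤ (a + b) (≤-trans 1≤a (m≤m+n a b)))
            (≤-trans (m≤m+n (a + b + (a + b)) (a + b)) (≤-reflexive (thrice (a + b))))
    where
    thrice : ∀ x → x + x + x ≡ 3 * x
    thrice = solve-∀

  ▷-lam-≤ : ∀ a b → 1 ≤ a → a + 1 + 2 * b ≤ 2 * (a + b)
  ▷-lam-≤ a b 1≤a = ≤-trans (+-monoˡ-≤ (2 * b) (+-monoʳ-≤ a 1≤a)) (≤-reflexive (expand a b))
    where
    expand : ∀ a b → a + a + 2 * b ≡ 2 * (a + b)
    expand = solve-∀

  ▷-left-≤ : ∀ a b c → 1 ≤ a → a + 1 + 1 + 3 * (b + c) ≤ 3 * (a + b + c)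
  ▷-left-≤ a b c 1≤a = ≤-trans (+-monoˡ-≤ (3 * (b + c)) (+-mono-≤ (+-monoʳ-≤ a 1≤a) 1≤a)) (≤-reflexive (expand a b c))
    where
    expand : ∀ a b c → a + a + a + 3 * (b + c) ≡ 3 * (a + b + c)
    expand = solve-∀

  ▷-right-≤ : ∀ a b c → 1 ≤ a → 1 + a + 1 + 3 * (b + c) ≤ 3 * (b + (a + c))
  ▷-right-≤ a b c 1≤a = ≤-trans (+-monoˡ-≤ (3 * (b + c)) (+-mono-≤ (+-monoˡ-≤ a 1≤a) 1≤a)) (≤-reflexive (expand a b c))
    where
    expand : ∀ a b c → a + a + a + 3 * (b + c) ≡ 3 * (b + (a + c))
    expand = solve-∀

  ▷-ins-≤ : ∀ x l X → 1 ≤ l → X ≡ x + l → 8 + l + 1 + suc (10 * x) ≤ suc (10 * X)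
  ▷-ins-≤ x l X 1≤l refl =
    ≤-trans (≤-reflexive (split x l)) (≤-trans (+-monoʳ-≤ (suc (10 * x) + l) (*-monoʳ-≤ 9 1≤l)) (≤-reflexive (merge x l)))
    where
    split : ∀ x l → 8 + l + 1 + suc (10 * x) ≡ suc (10 * x) + l + 9 * 1
    split = solve-∀
    merge : ∀ x l → suc (10 * x) + l + 9 * l ≡ suc (10 * (x + l))
    merge = solve-∀

  m≡n+1⇒n≤m : ∀ {m n} → m ≡ n + 1 → n ≤ m
  m≡n+1⇒n≤m {n = n} refl = m≤m+n n 1

wₘ-nonincreasing : ∀ {M N} → M ⟶ₘ N → wₘ N ≤ wₘ M
wₜ-nonincreasing : ∀ {q p} → q ⟶ₜ p → wₜ p ≤ wₜ q
wₛ-nonincreasing : ∀ {s u} → s ⟶ₛ u → wₛ u ≤ wₛ s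
wₘᵛ-nonincreasing : ∀ {n} {ϑ ϑ' : Vec Term n} → ϑ ⟶ₘᵛ ϑ' → wₘᵛ ϑ' ≤ wₘᵛ ϑ
wₜᵛ-nonincreasing : ∀ {n} {ζ ζ' : Vec Trail n} → ζ ⟶ₜᵛ ζ' → wₜᵛ ζ' ≤ wₜᵛ ζ

wₘ-nonincreasing σ-id = ≤-refl
wₘ-nonincreasing (σ-cons {M} {s}) = ≤-trans (m≤m⊔n (wₘ M) (wₛ s)) (≤-reflexive (sym (*-identityˡ _)))
wₘ-nonincreasing (σ-lam {M} {s}) =
  ≤-reflexive (trans (cong (λ z → 2 * (wₘ M * z)) (1⊔n*1≡n (wₛ s) (1≤wₛ s))) (sym (*-assoc 2 (wₘ M) (wₛ s))))
wₘ-nonincreasing (σ-app {M} {N} {s}) = ≤-reflexive (3*-distribʳ (wₘ M) (wₘ N) (wₛ s))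
wₘ-nonincreasing (σ-bang {s = s}) = ≤-trans (1≤wₛ s) (≤-reflexive (sym (*-identityˡ _)))
wₘ-nonincreasing (σ-let {M} {N} {s}) =
  ≤-reflexive (trans (cong (λ z → 3 * (wₘ M * wₛ s + wₘ N * z)) (1⊔n*1≡n (wₛ s) (1≤wₛ s))) (3*-distribʳ (wₘ M) (wₘ N) (wₛ s)))
wₘ-nonincreasing (σ-tr {q} {M} {s}) =
  ≤-trans (+-monoˡ-≤ (wₘ M * wₛ s) (m≤m*n⁺ (wₜ q) (wₛ s) (1≤wₛ s))) (≤-reflexive (sym (*-distribʳ-+ (wₛ s) (wₜ q) (wₘ M))))
wₘ-nonincreasing (σ-ins {ϑ} {s}) =
  ≤-trans (≤-reflexive (cong (λ z → suc (10 * z)) (wₘᵛ-map-[] ϑ s)))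
          (≤-trans (+-monoˡ-≤ (10 * (wₘᵛ ϑ * wₛ s)) (1≤wₛ s)) (≤-reflexive (distrib (wₘᵛ ϑ) (wₛ s))))
  where
  distrib : ∀ a c → c + 10 * (a * c) ≡ suc (10 * a) * c
  distrib = solve-∀
wₘ-nonincreasing (σ-clos {M} {s} {s'}) = ≤-reflexive (sym (*-assoc (wₘ M) (wₛ s) (wₛ s')))
wₘ-nonincreasing σ-er1 = ≤-refl
wₘ-nonincreasing σ-erups = ≤-refl
wₘ-nonincreasing σ-erlam = ≤-refl
wₘ-nonincreasing σ-erapp = ≤-refl
wₘ-nonincreasing σ-erbang = ≤-refl
wₘ-nonincreasing σ-erlet = ≤-refl
wₘ-nonincreasing (σ-ertr {q} {M}) = m≤n+m (wₘ M) (wₜ q)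
wₘ-nonincreasing (σ-erins {ϑ}) = ≤-reflexive (cong (λ z → suc (10 * z)) (wₘᵛ-map-er ϑ))
wₘ-nonincreasing τ-r = n≤1+n _
wₘ-nonincreasing (τ-tt {q} {q'} {M}) = ≤-reflexive (+-assoc (wₜ q) (wₜ q') (wₘ M))
wₘ-nonincreasing τ-bang = ≤-refl
wₘ-nonincreasing (τ-lam {q} {M}) = ▷-lam-≤ (wₜ q) (wₘ M) (1≤wₜ q)
wₘ-nonincreasing (τ-appL {q} {M} {N}) = ▷-left-≤ (wₜ q) (wₘ M) (wₘ N) (1≤wₜ q)
wₘ-nonincreasing (τ-appR {q} {M} {N}) = ▷-right-≤ (wₜ q) (wₘ M) (wₘ N) (1≤wₜ q)
wₘ-nonincreasing (τ-letL {q} {M} {N}) = ▷-left-≤ (wₜ q) (wₘ M) (wₘ N) (1≤wₜ q)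
wₘ-nonincreasing (τ-letR {q} {M} {N}) = ▷-right-≤ (wₜ q) (wₘ M) (wₘ N) (1≤wₜ q)
wₘ-nonincreasing (τ-ins {ϑ} {q} {M} i eq) =
  subst (λ z → z + 1 + suc (10 * wₘᵛ (ϑ [ i ]≔ M)) ≤ suc (10 * wₘᵛ ϑ)) (sym (wₜᵛ-replicate-r-update 8 i q))
        (▷-ins-≤ (wₘᵛ (ϑ [ i ]≔ M)) (wₜ q) (wₘᵛ ϑ) (1≤wₜ q) wₘᵛ≡)
  where
  wₘᵛ≡ : wₘᵛ ϑ ≡ wₘᵛ (ϑ [ i ]≔ M) + wₜ q
  wₘᵛ≡ = sym (+-cancelʳ-≡ (wₘ M) _ _
           (trans (+-assoc (wₘᵛ (ϑ [ i ]≔ M)) (wₜ q) (wₘ M))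
                  (trans (cong (λ z → wₘᵛ (ϑ [ i ]≔ M) + wₘ z) (sym eq)) (wₘᵛ-update ϑ i M))))
wₘ-nonincreasing (c-lam st) = *-monoʳ-≤ 2 (wₘ-nonincreasing st)
wₘ-nonincreasing (c-appL {N = N} st) = *-monoʳ-≤ 3 (+-monoˡ-≤ (wₘ N) (wₘ-nonincreasing st))
wₘ-nonincreasing (c-appR {M = M} st) = *-monoʳ-≤ 3 (+-monoʳ-≤ (wₘ M) (wₘ-nonincreasing st))
wₘ-nonincreasing (c-letL {N = N} st) = *-monoʳ-≤ 3 (+-monoˡ-≤ (wₘ N) (wₘ-nonincreasing st))
wₘ-nonincreasing (c-letR {M = M} st) = *-monoʳ-≤ 3 (+-monoʳ-≤ (wₘ M) (wₘ-nonincreasing st))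
wₘ-nonincreasing (c-bangQ st) = ≤-refl
wₘ-nonincreasing (c-bangM st) = ≤-refl
wₘ-nonincreasing (c-trQ {M = M} st) = +-monoˡ-≤ (wₘ M) (wₜ-nonincreasing st)
wₘ-nonincreasing (c-trM {q = q} st) = +-monoʳ-≤ (wₜ q) (wₘ-nonincreasing st)
wₘ-nonincreasing (c-ins st) = s≤s (*-monoʳ-≤ 10 (wₘᵛ-nonincreasing st))
wₘ-nonincreasing (c-clM {s = s} st) = *-monoˡ-≤ (wₛ s) (wₘ-nonincreasing st)
wₘ-nonincreasing (c-clS {M} st) = *-monoʳ-≤ (wₘ M) (wₛ-nonincreasing st)
wₘ-nonincreasing (c-er st) = wₘ-nonincreasing st

wₜ-nonincreasing σ-tl1 = ≤-refl
wₜ-nonincreasing (σ-tlups {n}) = 1≤wₘ (one [ ups n ])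
wₜ-nonincreasing (σ-tllam {M}) = n+1≤2*n (wₘ M) (1≤wₘ M)
wₜ-nonincreasing (σ-tlapp {M} {N}) = n+m+1≤3*[n+m] (wₘ M) (wₘ N) (1≤wₘ M)
wₜ-nonincreasing σ-tlbang = ≤-refl
wₜ-nonincreasing (σ-tllet {M} {N}) = n+m+1≤3*[n+m] (wₘ M) (wₘ N) (1≤wₘ M)
wₜ-nonincreasing σ-tltr = ≤-refl
wₜ-nonincreasing (σ-tlins {ϑ}) =
  ≤-trans (≤-reflexive (trans (cong (_+ 1) (wₜᵛ-map-tl ϑ)) (+-comm (wₘᵛ ϑ) 1))) (s≤s (m≤m+n (wₘᵛ ϑ) _))
wₜ-nonincreasing (τ-tr {q}) = m≤m+n (wₜ q) 1
wₜ-nonincreasing (τ-rt {q}) = n≤1+n (wₜ q)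
wₜ-nonincreasing τ-trr = m≤n+m 1 (wₜᵛ (replicate 9 r))
wₜ-nonincreasing τ-apprr = s≤s z≤n
wₜ-nonincreasing τ-lamr = s≤s z≤n
wₜ-nonincreasing τ-letrr = s≤s z≤n
wₜ-nonincreasing (τ-assoc {q₁} {q₂} {q₃}) = ≤-reflexive (sym (+-assoc (wₜ q₁) (wₜ q₂) (wₜ q₃)))
wₜ-nonincreasing (τ-lamlam {q} {q'}) = m≡n+1⇒n≤m (e (wₜ q) (wₜ q'))
  where
  e : ∀ a b → a + 1 + (b + 1) ≡ a + b + 1 + 1
  e = solve-∀
wₜ-nonincreasing (τ-lamlam' {q₁} {q₁'} {q}) = m≡n+1⇒n≤m (e (wₜ q₁) (wₜ q₁') (wₜ q))
  where
  e : ∀ a b c → a + 1 + (b + 1 + c) ≡ a + b + 1 + c + 1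
  e = solve-∀
wₜ-nonincreasing (τ-appapp {q₁} {q₂} {q₁'} {q₂'}) = m≡n+1⇒n≤m (e (wₜ q₁) (wₜ q₂) (wₜ q₁') (wₜ q₂'))
  where
  e : ∀ a b c d → a + b + 1 + (c + d + 1) ≡ a + c + (b + d) + 1 + 1
  e = solve-∀
wₜ-nonincreasing (τ-appapp' {q₁} {q₂} {q₁'} {q₂'} {q}) = m≡n+1⇒n≤m (e (wₜ q₁) (wₜ q₂) (wₜ q₁') (wₜ q₂') (wₜ q))
  where
  e : ∀ a b c d x → a + b + 1 + (c + d + 1 + x) ≡ a + c + (b + d) + 1 + x + 1
  e = solve-∀
wₜ-nonincreasing (τ-letlet {q₁} {q₂} {q₁'} {q₂'}) = m≡n+1⇒n≤m (e (wₜ q₁) (wₜ q₂) (wₜ q₁') (wₜ q₂'))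
  where
  e : ∀ a b c d → a + b + 1 + (c + d + 1) ≡ a + c + (b + d) + 1 + 1
  e = solve-∀
wₜ-nonincreasing (τ-letlet' {q₁} {q₂} {q₁'} {q₂'} {q}) = m≡n+1⇒n≤m (e (wₜ q₁) (wₜ q₂) (wₜ q₁') (wₜ q₂') (wₜ q))
  where
  e : ∀ a b c d x → a + b + 1 + (c + d + 1 + x) ≡ a + c + (b + d) + 1 + x + 1
  e = solve-∀
wₜ-nonincreasing (τ-trtr {ζ} {ζ'}) =
  m≡n+1⇒n≤m (trans (e (wₜᵛ ζ) (wₜᵛ ζ')) (cong (λ z → z + 1 + 1) (sym (wₜᵛ-zipWith-t ζ ζ'))))
  where
  e : ∀ a b → a + 1 + (b + 1) ≡ a + b + 1 + 1
  e = solve-∀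
wₜ-nonincreasing (τ-trtr' {ζ} {ζ'} {q}) =
  m≡n+1⇒n≤m (trans (e (wₜᵛ ζ) (wₜᵛ ζ') (wₜ q)) (cong (λ z → z + 1 + wₜ q + 1) (sym (wₜᵛ-zipWith-t ζ ζ'))))
  where
  e : ∀ a b c → a + 1 + (b + 1 + c) ≡ a + b + 1 + c + 1
  e = solve-∀
wₜ-nonincreasing (c-tL {p = p} st) = +-monoˡ-≤ (wₜ p) (wₜ-nonincreasing st)
wₜ-nonincreasing (c-tR {q = q} st) = +-monoʳ-≤ (wₜ q) (wₜ-nonincreasing st)
wₜ-nonincreasing (c-lamT st) = +-monoˡ-≤ 1 (wₜ-nonincreasing st)
wₜ-nonincreasing (c-appTL {p = p} st) = +-monoˡ-≤ 1 (+-monoˡ-≤ (wₜ p) (wₜ-nonincreasing st))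
wₜ-nonincreasing (c-appTR {q = q} st) = +-monoˡ-≤ 1 (+-monoʳ-≤ (wₜ q) (wₜ-nonincreasing st))
wₜ-nonincreasing (c-letTL {p = p} st) = +-monoˡ-≤ 1 (+-monoˡ-≤ (wₜ p) (wₜ-nonincreasing st))
wₜ-nonincreasing (c-letTR {q = q} st) = +-monoˡ-≤ 1 (+-monoʳ-≤ (wₜ q) (wₜ-nonincreasing st))
wₜ-nonincreasing (c-trT st) = +-monoˡ-≤ 1 (wₜᵛ-nonincreasing st)
wₜ-nonincreasing (c-tl st) = wₘ-nonincreasing st

wₛ-nonincreasing (σ-idl {s}) = ≤-reflexive (sym (*-identityˡ (wₛ s)))
wₛ-nonincreasing σ-shid = ≤-refl
wₛ-nonincreasing (σ-shcons {M} {s}) = ≤-trans (m≤n⊔m (wₘ M) (wₛ s)) (≤-reflexive (sym (*-identityˡ _)))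
wₛ-nonincreasing (σ-map {M} {s} {s'}) = ≤-reflexive (sym (*-distribʳ-⊔ (wₛ s') (wₘ M) (wₛ s)))
wₛ-nonincreasing (σ-assoc {s₁} {s₂} {s₃}) = ≤-reflexive (sym (*-assoc (wₛ s₁) (wₛ s₂) (wₛ s₃)))
wₛ-nonincreasing (c-consM {s = s} st) = ⊔-monoˡ-≤ (wₛ s) (wₘ-nonincreasing st)
wₛ-nonincreasing (c-consS {M = M} st) = ⊔-monoʳ-≤ (wₘ M) (wₛ-nonincreasing st)
wₛ-nonincreasing (c-compL {u = u} st) = *-monoˡ-≤ (wₛ u) (wₛ-nonincreasing st)
wₛ-nonincreasing (c-compR {s = s} st) = *-monoʳ-≤ (wₛ s) (wₛ-nonincreasing st)

wₘᵛ-nonincreasing (here {ϑ = ϑ} st) = +-monoˡ-≤ (wₘᵛ ϑ) (wₘ-nonincreasing st)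
wₘᵛ-nonincreasing (there {M = M} st) = +-monoʳ-≤ (wₘ M) (wₘᵛ-nonincreasing st)
wₜᵛ-nonincreasing (here {ζ = ζ} st) = +-monoˡ-≤ (wₜᵛ ζ) (wₜ-nonincreasing st)
wₜᵛ-nonincreasing (there {q = q} st) = +-monoʳ-≤ (wₜ q) (wₜᵛ-nonincreasing st)

rankₘ : Term → ℕ
rankₛ : Subst → ℕ
rankₘᵛ : ∀ {n} → Vec Term n → ℕ
rankₘ one = 0
rankₘ (lam M) = suc (rankₘ M)
rankₘ (app M N) = rankₘ M ⊔ rankₘ N
rankₘ (letₘ M N) = rankₘ M ⊔ suc (rankₘ N)
rankₘ (bang q M) = rankₘ M
rankₘ (q ▷ M) = rankₘ M
rankₘ (ins ϑ) = rankₘᵛ ϑ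
rankₘ (M [ s ]) = rankₘ M + rankₛ s
rankₘ (er M) = rankₘ M
rankₛ idₛ = 0
rankₛ ↑ = 0
rankₛ (M ∷ₛ s) = rankₘ M ⊔ rankₛ s
rankₛ (s ∘ₛ u) = rankₛ s + rankₛ u
rankₘᵛ [] = 0
rankₘᵛ (M ∷ ϑ) = rankₘ M ⊔ rankₘᵛ ϑ

rankₘ-lookup : ∀ {n} (ϑ : Vec Term n) i → rankₘ (lookup ϑ i) ≤ rankₘᵛ ϑ
rankₘ-lookup (M ∷ ϑ) zero = m≤m⊔n _ _
rankₘ-lookup (M ∷ ϑ) (suc i) = ≤-trans (rankₘ-lookup ϑ i) (m≤n⊔m _ _)

rankₘᵛ-map-[] : ∀ {n} (ϑ : Vec Term n) s → rankₘᵛ (map (_[ s ]) ϑ) ≤ rankₘᵛ ϑ + rankₛ s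
rankₘᵛ-map-[] [] s = z≤n
rankₘᵛ-map-[] (M ∷ ϑ) s =
  ≤-trans (⊔-monoʳ-≤ (rankₘ M + rankₛ s) (rankₘᵛ-map-[] ϑ s))
          (≤-reflexive (sym (+-distribʳ-⊔ (rankₛ s) (rankₘ M) (rankₘᵛ ϑ))))

rankₘᵛ-map-er : ∀ {n} (ϑ : Vec Term n) → rankₘᵛ (map er ϑ) ≡ rankₘᵛ ϑ
rankₘᵛ-map-er [] = refl
rankₘᵛ-map-er (M ∷ ϑ) = cong (rankₘ M ⊔_) (rankₘᵛ-map-er ϑ)

rankₘᵛ-update : ∀ {n} (ϑ : Vec Term n) i M → rankₘ M ≤ rankₘ (lookup ϑ i) → rankₘᵛ (ϑ [ i ]≔ M) ≤ rankₘᵛ ϑ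
rankₘᵛ-update (N ∷ ϑ) zero M ≤ᵢ = ⊔-monoˡ-≤ (rankₘᵛ ϑ) ≤ᵢ
rankₘᵛ-update (N ∷ ϑ) (suc i) M ≤ᵢ = ⊔-monoʳ-≤ (rankₘ N) (rankₘᵛ-update ϑ i M ≤ᵢ)

rankₘ-nonincreasing : ∀ {M N} → M ⟶ₘ N → rankₘ N ≤ rankₘ M
rankₛ-nonincreasing : ∀ {s u} → s ⟶ₛ u → rankₛ u ≤ rankₛ s
rankₘᵛ-nonincreasing : ∀ {n} {ϑ ϑ' : Vec Term n} → ϑ ⟶ₘᵛ ϑ' → rankₘᵛ ϑ' ≤ rankₘᵛ ϑ

rankₘ-nonincreasing σ-id = ≤-refl
rankₘ-nonincreasing (σ-cons {M} {s}) = m≤m⊔n (rankₘ M) (rankₛ s)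
rankₘ-nonincreasing (σ-lam {M} {s}) = ≤-reflexive (cong (λ z → suc (rankₘ M + z)) (+-identityʳ (rankₛ s)))
rankₘ-nonincreasing (σ-app {M} {N} {s}) = ≤-reflexive (sym (+-distribʳ-⊔ (rankₛ s) (rankₘ M) (rankₘ N)))
rankₘ-nonincreasing σ-bang = ≤-refl
rankₘ-nonincreasing (σ-let {M} {N} {s}) =
  ≤-reflexive (trans (cong (λ z → (rankₘ M + rankₛ s) ⊔ suc (rankₘ N + z)) (+-identityʳ (rankₛ s)))
                     (sym (+-distribʳ-⊔ (rankₛ s) (rankₘ M) (suc (rankₘ N)))))
rankₘ-nonincreasing σ-tr = ≤-refl
rankₘ-nonincreasing (σ-ins {ϑ} {s}) = rankₘᵛ-map-[] ϑ s
rankₘ-nonincreasing (σ-clos {M} {s} {s'}) = ≤-reflexive (sym (+-assoc (rankₘ M) (rankₛ s) (rankₛ s')))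
rankₘ-nonincreasing σ-er1 = ≤-refl
rankₘ-nonincreasing σ-erups = ≤-refl
rankₘ-nonincreasing σ-erlam = ≤-refl
rankₘ-nonincreasing σ-erapp = ≤-refl
rankₘ-nonincreasing σ-erbang = ≤-refl
rankₘ-nonincreasing σ-erlet = ≤-refl
rankₘ-nonincreasing σ-ertr = ≤-refl
rankₘ-nonincreasing (σ-erins {ϑ}) = ≤-reflexive (rankₘᵛ-map-er ϑ)
rankₘ-nonincreasing τ-r = ≤-refl
rankₘ-nonincreasing τ-tt = ≤-refl
rankₘ-nonincreasing τ-bang = ≤-refl
rankₘ-nonincreasing τ-lam = ≤-refl
rankₘ-nonincreasing τ-appL = ≤-refl
rankₘ-nonincreasing τ-appR = ≤-refl
rankₘ-nonincreasing τ-letL = ≤-refl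
rankₘ-nonincreasing τ-letR = ≤-refl
rankₘ-nonincreasing (τ-ins {ϑ} {q} {M} i eq) = rankₘᵛ-update ϑ i M (≤-reflexive (cong rankₘ (sym eq)))
rankₘ-nonincreasing (c-lam st) = s≤s (rankₘ-nonincreasing st)
rankₘ-nonincreasing (c-appL st) = ⊔-monoˡ-≤ _ (rankₘ-nonincreasing st)
rankₘ-nonincreasing (c-appR st) = ⊔-monoʳ-≤ _ (rankₘ-nonincreasing st)
rankₘ-nonincreasing (c-letL st) = ⊔-monoˡ-≤ _ (rankₘ-nonincreasing st)
rankₘ-nonincreasing (c-letR st) = ⊔-monoʳ-≤ _ (s≤s (rankₘ-nonincreasing st))
rankₘ-nonincreasing (c-bangQ st) = ≤-refl
rankₘ-nonincreasing (c-bangM st) = rankₘ-nonincreasing st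
rankₘ-nonincreasing (c-trQ st) = ≤-refl
rankₘ-nonincreasing (c-trM st) = rankₘ-nonincreasing st
rankₘ-nonincreasing (c-ins st) = rankₘᵛ-nonincreasing st
rankₘ-nonincreasing (c-clM {s = s} st) = +-monoˡ-≤ (rankₛ s) (rankₘ-nonincreasing st)
rankₘ-nonincreasing (c-clS {M = M} st) = +-monoʳ-≤ (rankₘ M) (rankₛ-nonincreasing st)
rankₘ-nonincreasing (c-er st) = rankₘ-nonincreasing st

rankₛ-nonincreasing σ-idl = ≤-refl
rankₛ-nonincreasing σ-shid = ≤-refl
rankₛ-nonincreasing (σ-shcons {M} {s}) = m≤n⊔m (rankₘ M) (rankₛ s)
rankₛ-nonincreasing (σ-map {M} {s} {s'}) = ≤-reflexive (sym (+-distribʳ-⊔ (rankₛ s') (rankₘ M) (rankₛ s)))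
rankₛ-nonincreasing (σ-assoc {s₁} {s₂} {s₃}) = ≤-reflexive (sym (+-assoc (rankₛ s₁) (rankₛ s₂) (rankₛ s₃)))
rankₛ-nonincreasing (c-consM {s = s} st) = ⊔-monoˡ-≤ (rankₛ s) (rankₘ-nonincreasing st)
rankₛ-nonincreasing (c-consS {M = M} st) = ⊔-monoʳ-≤ (rankₘ M) (rankₛ-nonincreasing st)
rankₛ-nonincreasing (c-compL {u = u} st) = +-monoˡ-≤ (rankₛ u) (rankₛ-nonincreasing st)
rankₛ-nonincreasing (c-compR {s = s} st) = +-monoʳ-≤ (rankₛ s) (rankₛ-nonincreasing st)

rankₘᵛ-nonincreasing (here {ϑ = ϑ} st) = ⊔-monoˡ-≤ (rankₘᵛ ϑ) (rankₘ-nonincreasing st)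
rankₘᵛ-nonincreasing (there {M = M} st) = ⊔-monoʳ-≤ (rankₘ M) (rankₘᵛ-nonincreasing st)

acc-sub : ∀ {x y} → Acc _≺_ x → y ◁ x → Acc _≺_ y
acc-sub (acc rs) y◁x = rs (sub y◁x)

acc-one : Accₘ one
acc-one = acc-normal λ { (stepₘ ()) }

acc-r : Accₜ r
acc-r = acc-normal λ { (stepₜ ()) }

acc-ba : Accₜ ba
acc-ba = acc-normal λ { (stepₜ ()) }

acc-bb : Accₜ bb
acc-bb = acc-normal λ { (stepₜ ()) }

acc-ti : Accₜ ti
acc-ti = acc-normal λ { (stepₜ ()) }

acc-idₛ : Accₛ idₛ
acc-idₛ = acc-normal λ { (stepₛ ()) }

acc-↑ : Accₛ ↑
acc-↑ = acc-normal λ { (stepₛ ()) }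

acc-replicate-r : ∀ n → Acc _≺ₜᵛ_ (replicate n r)
acc-replicate-r zero = acc λ ()
acc-replicate-r (suc n) = acc-∷ (accessible trail acc-r) (acc-replicate-r n)

acc-replicate-r-update : ∀ {n q} (i : Fin n) → Accₜ q → Acc _≺ₜᵛ_ (replicate n r [ i ]≔ q)
acc-replicate-r-update {suc n} zero aq = acc-∷ (accessible trail aq) (acc-replicate-r n)
acc-replicate-r-update {suc n} (suc i) aq = acc-∷ (accessible trail acc-r) (acc-replicate-r-update i aq)

acc-lamT : ∀ {q} → Accₜ q → Accₜ (lamT q)
acc-lamT (acc rq) = acc-by-reducts λ where
  (stepₜ τ-lamr) → acc-r
  (stepₜ (c-lamT st)) → acc-lamT (rq (red (stepₜ st)))

acc-appT : ∀ {q p} → Accₜ q → Accₜ p → Accₜ (appT q p)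
acc-appT aq@(acc rq) ap@(acc rp) = acc-by-reducts λ where
  (stepₜ τ-apprr) → acc-r
  (stepₜ (c-appTL st)) → acc-appT (rq (red (stepₜ st))) ap
  (stepₜ (c-appTR st)) → acc-appT aq (rp (red (stepₜ st)))

acc-letT : ∀ {q p} → Accₜ q → Accₜ p → Accₜ (letT q p)
acc-letT aq@(acc rq) ap@(acc rp) = acc-by-reducts λ where
  (stepₜ τ-letrr) → acc-r
  (stepₜ (c-letTL st)) → acc-letT (rq (red (stepₜ st))) ap
  (stepₜ (c-letTR st)) → acc-letT aq (rp (red (stepₜ st)))

acc-trT : ∀ {ζ} → Acc _≺ₜᵛ_ ζ → Accₜ (trT ζ)
acc-trT (acc rζ) = acc-by-reducts λ where
  (stepₜ τ-trr) → acc-r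
  (stepₜ (c-trT st)) → acc-trT (rζ (⟶ₜᵛ⇒≺ₜᵛ st))

acc-trT-lookup : ∀ (ζ : Vec Trail 9) → (∀ i → Accₜ (lookup ζ i)) → Accₜ (trT ζ)
acc-trT-lookup ζ f = acc-trT (acc-somewhere ζ (λ i → accessible trail (f i)))

private
  slack-≤ : ∀ {x y n} k → x + k ≡ y → y ≤ n → x ≤ n
  slack-≤ {x} k refl y≤n = ≤-trans (m≤m+n x k) y≤n

  slack-< : ∀ {x y n} k → x + suc k ≡ y → y ≤ n → x < n
  slack-< {x} k refl y≤n = ≤-trans (s≤s (m≤m+n x k)) (≤-trans (≤-reflexive (sym (+-suc x k))) y≤n)

  wₜ-lookup : ∀ {n} (ζ : Vec Trail n) i → wₜ (lookup ζ i) ≤ wₜᵛ ζ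
  wₜ-lookup (q ∷ ζ) zero = m≤m+n _ _
  wₜ-lookup (q ∷ ζ) (suc i) = ≤-trans (wₜ-lookup ζ i) (m≤n+m _ _)

  wₜ-lookup₂ : ∀ {n} (ζ ζ' : Vec Trail 9) i → wₜᵛ ζ + 1 + (wₜᵛ ζ' + 1) ≤ n →
               wₜ (lookup ζ i) + wₜ (lookup ζ' i) ≤ n
  wₜ-lookup₂ ζ ζ' i =
    ≤-trans (+-mono-≤ (≤-trans (wₜ-lookup ζ i) (m≤m+n _ 1)) (≤-trans (wₜ-lookup ζ' i) (m≤m+n _ 1)))

  assoc-slack : ∀ a b c → a + (b + c) + 0 ≡ a + b + c
  assoc-slack = solve-∀

  lamlam-slack : ∀ a b → a + b + 2 ≡ a + 1 + (b + 1)
  lamlam-slack = solve-∀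

  lamlam'-outer : ∀ a b c → a + b + 1 + c + 1 ≡ a + 1 + (b + 1 + c)
  lamlam'-outer = solve-∀

  lamlam'-inner : ∀ a b c → a + b + (c + 2) ≡ a + 1 + (b + 1 + c)
  lamlam'-inner = solve-∀

  binary-left : ∀ a b c d → a + c + (b + d + 2) ≡ a + b + 1 + (c + d + 1)
  binary-left = solve-∀

  binary-right : ∀ a b c d → b + d + (a + c + 2) ≡ a + b + 1 + (c + d + 1)
  binary-right = solve-∀

  binary'-outer : ∀ a b c d x → a + c + (b + d) + 1 + x + 1 ≡ a + b + 1 + (c + d + 1 + x)
  binary'-outer = solve-∀

  binary'-left : ∀ a b c d x → a + c + (b + d + x + 2) ≡ a + b + 1 + (c + d + 1 + x)
  binary'-left = solve-∀

  binary'-right : ∀ a b c d x → b + d + (a + c + x + 2) ≡ a + b + 1 + (c + d + 1 + x)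
  binary'-right = solve-∀

acc-t-≤ : ∀ {n a b} → Acc _<_ n → wₜ a + wₜ b ≤ n → Accₜ a → Accₜ b → Accₜ (t a b)
acc-t-≤-reducts : ∀ {n a b y} → Acc _<_ n → wₜ a + wₜ b ≤ n → Accₜ a → Accₜ b → trail (t a b) ⟶ y → Acc _≺_ y
acc-t-≤ an w≤n aa ab = acc-by-reducts (acc-t-≤-reducts an w≤n aa ab)

acc-t-≤-reducts _ _ aa _ (stepₜ τ-tr) = aa
acc-t-≤-reducts _ _ _ ab (stepₜ τ-rt) = ab
acc-t-≤-reducts an w≤n (acc ra) ab (stepₜ (τ-assoc {q₁} {q₂} {q₃})) =
  acc-t-≤ an (slack-≤ 0 (assoc-slack (wₜ q₁) (wₜ q₂) (wₜ q₃)) w≤n) (ra (sub tL◁))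
    (acc-t-≤ an (≤-trans (m≤n+m _ (wₜ q₁)) (≤-trans (≤-reflexive (sym (+-assoc (wₜ q₁) _ _))) w≤n))
       (ra (sub tR◁)) ab)
acc-t-≤-reducts an w≤n (acc ra) (acc rb) (stepₜ (τ-lamlam {q} {q'})) =
  acc-lamT (acc-t-≤ an (slack-≤ 2 (lamlam-slack (wₜ q) (wₜ q')) w≤n) (ra (sub lamT◁)) (rb (sub lamT◁)))
acc-t-≤-reducts an@(acc rn) w≤n (acc ra) (acc rb) (stepₜ (τ-lamlam' {q₁} {q₁'} {q})) =
  acc-t-≤ (rn (slack-< 0 (lamlam'-outer (wₜ q₁) (wₜ q₁') (wₜ q)) w≤n)) ≤-refl
    (acc-lamT (acc-t-≤ an (slack-≤ (wₜ q + 2) (lamlam'-inner (wₜ q₁) (wₜ q₁') (wₜ q)) w≤n)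
                (ra (sub lamT◁)) (acc-sub (rb (sub tL◁)) lamT◁)))
    (rb (sub tR◁))
acc-t-≤-reducts an w≤n (acc ra) (acc rb) (stepₜ (τ-appapp {q₁} {q₂} {q₁'} {q₂'})) =
  acc-appT (acc-t-≤ an (slack-≤ _ (binary-left (wₜ q₁) (wₜ q₂) (wₜ q₁') (wₜ q₂')) w≤n)
              (ra (sub appTL◁)) (rb (sub appTL◁)))
           (acc-t-≤ an (slack-≤ _ (binary-right (wₜ q₁) (wₜ q₂) (wₜ q₁') (wₜ q₂')) w≤n)
              (ra (sub appTR◁)) (rb (sub appTR◁)))
acc-t-≤-reducts an@(acc rn) w≤n (acc ra) (acc rb) (stepₜ (τ-appapp' {q₁} {q₂} {q₁'} {q₂'} {q})) =
  acc-t-≤ (rn (slack-< 0 (binary'-outer (wₜ q₁) (wₜ q₂) (wₜ q₁') (wₜ q₂') (wₜ q)) w≤n)) ≤-refl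
    (acc-appT (acc-t-≤ an (slack-≤ _ (binary'-left (wₜ q₁) (wₜ q₂) (wₜ q₁') (wₜ q₂') (wₜ q)) w≤n)
                 (ra (sub appTL◁)) (acc-sub (rb (sub tL◁)) appTL◁))
              (acc-t-≤ an (slack-≤ _ (binary'-right (wₜ q₁) (wₜ q₂) (wₜ q₁') (wₜ q₂') (wₜ q)) w≤n)
                 (ra (sub appTR◁)) (acc-sub (rb (sub tL◁)) appTR◁)))
    (rb (sub tR◁))
acc-t-≤-reducts an w≤n (acc ra) (acc rb) (stepₜ (τ-letlet {q₁} {q₂} {q₁'} {q₂'})) =
  acc-letT (acc-t-≤ an (slack-≤ _ (binary-left (wₜ q₁) (wₜ q₂) (wₜ q₁') (wₜ q₂')) w≤n)
              (ra (sub letTL◁)) (rb (sub letTL◁)))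
           (acc-t-≤ an (slack-≤ _ (binary-right (wₜ q₁) (wₜ q₂) (wₜ q₁') (wₜ q₂')) w≤n)
              (ra (sub letTR◁)) (rb (sub letTR◁)))
acc-t-≤-reducts an@(acc rn) w≤n (acc ra) (acc rb) (stepₜ (τ-letlet' {q₁} {q₂} {q₁'} {q₂'} {q})) =
  acc-t-≤ (rn (slack-< 0 (binary'-outer (wₜ q₁) (wₜ q₂) (wₜ q₁') (wₜ q₂') (wₜ q)) w≤n)) ≤-refl
    (acc-letT (acc-t-≤ an (slack-≤ _ (binary'-left (wₜ q₁) (wₜ q₂) (wₜ q₁') (wₜ q₂') (wₜ q)) w≤n)
                 (ra (sub letTL◁)) (acc-sub (rb (sub tL◁)) letTL◁))
              (acc-t-≤ an (slack-≤ _ (binary'-right (wₜ q₁) (wₜ q₂) (wₜ q₁') (wₜ q₂') (wₜ q)) w≤n)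
                 (ra (sub letTR◁)) (acc-sub (rb (sub tL◁)) letTR◁)))
    (rb (sub tR◁))
acc-t-≤-reducts an w≤n (acc ra) (acc rb) (stepₜ (τ-trtr {ζ} {ζ'})) =
  acc-trT-lookup (zipWith t ζ ζ') λ i →
    subst Accₜ (sym (lookup-zipWith t i ζ ζ'))
      (acc-t-≤ an (wₜ-lookup₂ ζ ζ' i w≤n) (ra (sub (trT◁ i))) (rb (sub (trT◁ i))))
acc-t-≤-reducts an@(acc rn) w≤n (acc ra) (acc rb) (stepₜ (τ-trtr' {ζ} {ζ'} {q})) =
  acc-t-≤ (rn (slack-< 0 (trans (cong (λ z → z + 1 + wₜ q + 1) (wₜᵛ-zipWith-t ζ ζ'))
                                (lamlam'-outer (wₜᵛ ζ) (wₜᵛ ζ') (wₜ q))) w≤n)) ≤-refl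
    (acc-trT-lookup (zipWith t ζ ζ') λ i →
      subst Accₜ (sym (lookup-zipWith t i ζ ζ'))
        (acc-t-≤ an (wₜ-lookup₂ ζ ζ' i (≤-trans (+-monoʳ-≤ (wₜᵛ ζ + 1) (m≤m+n _ (wₜ q))) w≤n))
           (ra (sub (trT◁ i))) (acc-sub (rb (sub tL◁)) (trT◁ i))))
    (rb (sub tR◁))
acc-t-≤-reducts an w≤n (acc ra) ab (stepₜ (c-tL {p = p} st)) =
  acc-t-≤ an (≤-trans (+-monoˡ-≤ (wₜ p) (wₜ-nonincreasing st)) w≤n) (ra (red (stepₜ st))) ab
acc-t-≤-reducts an w≤n aa (acc rb) (stepₜ (c-tR {q = q} st)) =
  acc-t-≤ an (≤-trans (+-monoʳ-≤ (wₜ q) (wₜ-nonincreasing st)) w≤n) aa (rb (red (stepₜ st)))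

acc-t : ∀ {a b} → Accₜ a → Accₜ b → Accₜ (t a b)
acc-t = acc-t-≤ (<-wellFounded _) ≤-refl

acc-tl : ∀ {M} → Accₘ M → Accₜ (tl M)
acc-tl (acc rM) = acc-by-reducts λ where
  (stepₜ σ-tl1) → acc-r
  (stepₜ σ-tlups) → acc-r
  (stepₜ σ-tllam) → acc-lamT (acc-tl (rM (sub lam◁)))
  (stepₜ σ-tlapp) → acc-appT (acc-tl (rM (sub appL◁))) (acc-tl (rM (sub appR◁)))
  (stepₜ σ-tlbang) → acc-r
  (stepₜ σ-tllet) → acc-letT (acc-tl (rM (sub letL◁))) (acc-tl (rM (sub letR◁)))
  (stepₜ σ-tltr) → acc-t (rM (sub trQ◁)) (acc-tl (rM (sub trM◁)))
  (stepₜ (σ-tlins {ϑ})) → acc-trT-lookup (map tl ϑ) λ i →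
    subst Accₜ (sym (lookup-map i tl ϑ)) (acc-tl (rM (sub (ins◁ i))))
  (stepₜ (c-tl st)) → acc-tl (rM (red (stepₘ st)))

acc-▷ : ∀ {q M} → Accₜ q → Accₘ M → Accₘ (q ▷ M)
acc-▷-reducts : ∀ {q M y} → Accₜ q → Accₘ M → term (q ▷ M) ⟶ y → Acc _≺_ y
acc-▷ aq aM = acc-by-reducts (acc-▷-reducts aq aM)

acc-▷-reducts _ aM (stepₘ τ-r) = aM
acc-▷-reducts aq (acc rM) (stepₘ τ-tt) = acc-▷ (acc-t aq (rM (sub trQ◁))) (rM (sub trM◁))
acc-▷-reducts (acc rq) aM (stepₘ (c-trQ st)) = acc-▷ (rq (red (stepₜ st))) aM
acc-▷-reducts aq (acc rM) (stepₘ (c-trM st)) = acc-▷ aq (rM (red (stepₘ st)))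

acc-lam : ∀ {M} → Accₘ M → Accₘ (lam M)
acc-lam (acc rM) = acc-by-reducts λ where
  (stepₘ τ-lam) → acc-▷ (acc-lamT (rM (sub trQ◁))) (acc-lam (rM (sub trM◁)))
  (stepₘ (c-lam st)) → acc-lam (rM (red (stepₘ st)))

acc-app : ∀ {M N} → Accₘ M → Accₘ N → Accₘ (app M N)
acc-app aM@(acc rM) aN@(acc rN) = acc-by-reducts λ where
  (stepₘ τ-appL) → acc-▷ (acc-appT (rM (sub trQ◁)) acc-r) (acc-app (rM (sub trM◁)) aN)
  (stepₘ τ-appR) → acc-▷ (acc-appT acc-r (rN (sub trQ◁))) (acc-app aM (rN (sub trM◁)))
  (stepₘ (c-appL st)) → acc-app (rM (red (stepₘ st))) aN
  (stepₘ (c-appR st)) → acc-app aM (rN (red (stepₘ st)))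

acc-let : ∀ {M N} → Accₘ M → Accₘ N → Accₘ (letₘ M N)
acc-let aM@(acc rM) aN@(acc rN) = acc-by-reducts λ where
  (stepₘ τ-letL) → acc-▷ (acc-letT (rM (sub trQ◁)) acc-r) (acc-let (rM (sub trM◁)) aN)
  (stepₘ τ-letR) → acc-▷ (acc-letT acc-r (rN (sub trQ◁))) (acc-let aM (rN (sub trM◁)))
  (stepₘ (c-letL st)) → acc-let (rM (red (stepₘ st))) aN
  (stepₘ (c-letR st)) → acc-let aM (rN (red (stepₘ st)))

acc-bang : ∀ {q M} → Accₜ q → Accₘ M → Accₘ (bang q M)
acc-bang-reducts : ∀ {q M y} → Accₜ q → Accₘ M → term (bang q M) ⟶ y → Acc _≺_ y
acc-bang aq aM = acc-by-reducts (acc-bang-reducts aq aM)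

acc-bang-reducts aq (acc rM) (stepₘ τ-bang) = acc-bang (acc-t aq (rM (sub trQ◁))) (rM (sub trM◁))
acc-bang-reducts (acc rq) aM (stepₘ (c-bangQ st)) = acc-bang (rq (red (stepₜ st))) aM
acc-bang-reducts aq (acc rM) (stepₘ (c-bangM st)) = acc-bang aq (rM (red (stepₘ st)))

All-⟶ₘᵛ : ∀ {n} {ϑ ϑ' : Vec Term n} → ϑ ⟶ₘᵛ ϑ' → All Accₘ ϑ → All Accₘ ϑ'
All-⟶ₘᵛ (here st) (acc rM ∷ aϑ) = rM (red (stepₘ st)) ∷ aϑ
All-⟶ₘᵛ (there st) (aM ∷ aϑ) = aM ∷ All-⟶ₘᵛ st aϑ

All-[]≔ : ∀ {n} {ϑ : Vec Term n} (i : Fin n) {M} → Accₘ M → All Accₘ ϑ → All Accₘ (ϑ [ i ]≔ M)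
All-[]≔ zero aM (_ ∷ aϑ) = aM ∷ aϑ
All-[]≔ (suc i) aM (aN ∷ aϑ) = aN ∷ All-[]≔ i aM aϑ

-- Accessibility for the family order does not give that of the components
-- (their subexpressions may be trails), so both are assumed.
acc-ins : ∀ {ϑ} → Acc _≺ₘᵛ_ ϑ → All Accₘ ϑ → Accₘ (ins ϑ)
acc-ins (acc rϑ) aϑ = acc-by-reducts λ where
  (stepₘ (τ-ins {q = q} {M = M} i eq)) →
    let aqM = subst Accₘ eq (lookup⁺ aϑ i) in
    acc-▷ (acc-trT (acc-replicate-r-update i (acc-sub aqM trQ◁)))
          (acc-ins (rϑ (somewhere-update i (subst (λ N → term M ≺ term N) (sym eq) (sub trM◁))))
                   (All-[]≔ i (acc-sub aqM trM◁) aϑ))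
  (stepₘ (c-ins st)) → acc-ins (rϑ (⟶ₘᵛ⇒≺ₘᵛ st)) (All-⟶ₘᵛ st aϑ)

acc-ins-lookup : ∀ (ϑ : Vec Term 9) → (∀ i → Accₘ (lookup ϑ i)) → Accₘ (ins ϑ)
acc-ins-lookup ϑ f = acc-ins (acc-somewhere ϑ (λ i → accessible term (f i))) (lookup⁻ f)

acc-er : ∀ {M} → Accₘ M → Accₘ (er M)
acc-er aM@(acc rM) = acc-by-reducts λ where
  (stepₘ σ-er1) → acc-one
  (stepₘ σ-erups) → aM
  (stepₘ σ-erlam) → acc-lam (acc-er (rM (sub lam◁)))
  (stepₘ σ-erapp) → acc-app (acc-er (rM (sub appL◁))) (acc-er (rM (sub appR◁)))
  (stepₘ σ-erbang) → aM
  (stepₘ σ-erlet) → acc-let (acc-er (rM (sub letL◁))) (acc-er (rM (sub letR◁)))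
  (stepₘ σ-ertr) → acc-er (rM (sub trM◁))
  (stepₘ (σ-erins {ϑ})) → acc-ins-lookup (map er ϑ) λ i →
    subst Accₘ (sym (lookup-map i er ϑ)) (acc-er (rM (sub (ins◁ i))))
  (stepₘ (c-er st)) → acc-er (rM (red (stepₘ st)))

acc-∷ₛ : ∀ {M s} → Accₘ M → Accₛ s → Accₛ (M ∷ₛ s)
acc-∷ₛ aM@(acc rM) as@(acc rs) = acc-by-reducts λ where
  (stepₛ (c-consM st)) → acc-∷ₛ (rM (red (stepₘ st))) as
  (stepₛ (c-consS st)) → acc-∷ₛ aM (rs (red (stepₛ st)))

private
  under-binder : ∀ a b {n} → suc a + b ≤ n → (b + 0 < n) × (a + (b + 0) ≤ n)
  under-binder a b sa+b≤n =
    ≤-trans (s≤s (≤-trans (≤-reflexive (+-identityʳ b)) (m≤n+m b a))) sa+b≤n ,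
    ≤-trans (≤-reflexive (cong (a +_) (+-identityʳ b))) (≤-trans (n≤1+n _) sa+b≤n)

  ⊔-bounds : ∀ a b c {n} → (a ⊔ b) + c ≤ n → (a + c ≤ n) × (b + c ≤ n)
  ⊔-bounds a b c ≤n = ≤-trans (+-monoˡ-≤ c (m≤m⊔n a b)) ≤n , ≤-trans (+-monoˡ-≤ c (m≤n⊔m a b)) ≤n

  assoc-bounds : ∀ a b c {n} → a + b + c ≤ n → (a + (b + c) ≤ n) × (b + c ≤ n)
  assoc-bounds a b c ≤n =
    ≤-trans (≤-reflexive (sym (+-assoc a b c))) ≤n ,
    ≤-trans (m≤n+m (b + c) a) (≤-trans (≤-reflexive (sym (+-assoc a b c))) ≤n)

acc-[]-≤ : ∀ {n M s} → Acc _<_ n → rankₘ M + rankₛ s ≤ n → Accₘ M → Accₛ s → Accₘ (M [ s ])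
acc-∘ₛ-≤ : ∀ {n s u} → Acc _<_ n → rankₛ s + rankₛ u ≤ n → Accₛ s → Accₛ u → Accₛ (s ∘ₛ u)
acc-[]-≤-reducts : ∀ {n M s y} → Acc _<_ n → rankₘ M + rankₛ s ≤ n → Accₘ M → Accₛ s →
                   term (M [ s ]) ⟶ y → Acc _≺_ y
acc-∘ₛ-≤-reducts : ∀ {n s u y} → Acc _<_ n → rankₛ s + rankₛ u ≤ n → Accₛ s → Accₛ u →
                   subs (s ∘ₛ u) ⟶ y → Acc _≺_ y
acc-[]-≤ an ≤n aM as = acc-by-reducts (acc-[]-≤-reducts an ≤n aM as)
acc-∘ₛ-≤ an ≤n as au = acc-by-reducts (acc-∘ₛ-≤-reducts an ≤n as au)

acc-[]-≤-reducts _ _ _ _ (stepₘ σ-id) = acc-one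
acc-[]-≤-reducts _ _ _ (acc rs) (stepₘ σ-cons) = rs (sub consM◁)
acc-[]-≤-reducts {s = s} an@(acc rn) ≤n (acc rM) as (stepₘ (σ-lam {M})) =
  let (<n , ≤n') = under-binder (rankₘ M) (rankₛ s) ≤n in
  acc-lam (acc-[]-≤ an ≤n' (rM (sub lam◁)) (acc-∷ₛ acc-one (acc-∘ₛ-≤ (rn <n) ≤-refl as acc-↑)))
acc-[]-≤-reducts {s = s} an ≤n (acc rM) as (stepₘ (σ-app {M} {N})) =
  let (≤n₁ , ≤n₂) = ⊔-bounds (rankₘ M) (rankₘ N) (rankₛ s) ≤n in
  acc-app (acc-[]-≤ an ≤n₁ (rM (sub appL◁)) as) (acc-[]-≤ an ≤n₂ (rM (sub appR◁)) as)
acc-[]-≤-reducts an ≤n (acc rM) as (stepₘ σ-bang) = acc-bang (rM (sub bangQ◁)) (acc-[]-≤ an ≤n (rM (sub bangM◁)) as)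
acc-[]-≤-reducts {s = s} an@(acc rn) ≤n (acc rM) as (stepₘ (σ-let {M} {N})) =
  let (≤n₁ , ≤n₂) = ⊔-bounds (rankₘ M) (suc (rankₘ N)) (rankₛ s) ≤n
      (<n , ≤n₂') = under-binder (rankₘ N) (rankₛ s) ≤n₂ in
  acc-let (acc-[]-≤ an ≤n₁ (rM (sub letL◁)) as)
          (acc-[]-≤ an ≤n₂' (rM (sub letR◁)) (acc-∷ₛ acc-one (acc-∘ₛ-≤ (rn <n) ≤-refl as acc-↑)))
acc-[]-≤-reducts an ≤n (acc rM) as (stepₘ σ-tr) = acc-▷ (rM (sub trQ◁)) (acc-[]-≤ an ≤n (rM (sub trM◁)) as)
acc-[]-≤-reducts {s = s} an ≤n (acc rM) as (stepₘ (σ-ins {ϑ})) =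
  acc-ins-lookup (map (_[ s ]) ϑ) λ i →
    subst Accₘ (sym (lookup-map i (_[ s ]) ϑ))
      (acc-[]-≤ an (≤-trans (+-monoˡ-≤ (rankₛ s) (rankₘ-lookup ϑ i)) ≤n) (rM (sub (ins◁ i))) as)
acc-[]-≤-reducts {s = s} an ≤n (acc rM) as (stepₘ (σ-clos {M} {s'})) =
  let (≤n' , ≤n'') = assoc-bounds (rankₘ M) (rankₛ s') (rankₛ s) ≤n in
  acc-[]-≤ an ≤n' (rM (sub clM◁)) (acc-∘ₛ-≤ an ≤n'' (rM (sub clS◁)) as)
acc-[]-≤-reducts {s = s} an ≤n (acc rM) as (stepₘ (c-clM st)) =
  acc-[]-≤ an (≤-trans (+-monoˡ-≤ (rankₛ s) (rankₘ-nonincreasing st)) ≤n) (rM (red (stepₘ st))) as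
acc-[]-≤-reducts {M = M} an ≤n aM (acc rs) (stepₘ (c-clS st)) =
  acc-[]-≤ an (≤-trans (+-monoʳ-≤ (rankₘ M) (rankₛ-nonincreasing st)) ≤n) aM (rs (red (stepₛ st)))

acc-∘ₛ-≤-reducts _ _ _ au (stepₛ σ-idl) = au
acc-∘ₛ-≤-reducts _ _ _ _ (stepₛ σ-shid) = acc-↑
acc-∘ₛ-≤-reducts _ _ _ (acc ru) (stepₛ σ-shcons) = ru (sub consS◁)
acc-∘ₛ-≤-reducts {u = u} an ≤n (acc rs) au (stepₛ (σ-map {M} {s})) =
  let (≤n₁ , ≤n₂) = ⊔-bounds (rankₘ M) (rankₛ s) (rankₛ u) ≤n in
  acc-∷ₛ (acc-[]-≤ an ≤n₁ (rs (sub consM◁)) au) (acc-∘ₛ-≤ an ≤n₂ (rs (sub consS◁)) au)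
acc-∘ₛ-≤-reducts {u = u} an ≤n (acc rs) au (stepₛ (σ-assoc {s₁} {s₂})) =
  let (≤n' , ≤n'') = assoc-bounds (rankₛ s₁) (rankₛ s₂) (rankₛ u) ≤n in
  acc-∘ₛ-≤ an ≤n' (rs (sub compL◁)) (acc-∘ₛ-≤ an ≤n'' (rs (sub compR◁)) au)
acc-∘ₛ-≤-reducts {u = u} an ≤n (acc rs) au (stepₛ (c-compL st)) =
  acc-∘ₛ-≤ an (≤-trans (+-monoˡ-≤ (rankₛ u) (rankₛ-nonincreasing st)) ≤n) (rs (red (stepₛ st))) au
acc-∘ₛ-≤-reducts {s = s} an ≤n as (acc ru) (stepₛ (c-compR st)) =
  acc-∘ₛ-≤ an (≤-trans (+-monoʳ-≤ (rankₛ s) (rankₛ-nonincreasing st)) ≤n) as (ru (red (stepₛ st)))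

accₘ : ∀ M → Accₘ M
accₜ : ∀ q → Accₜ q
accₛ : ∀ s → Accₛ s
accₘ-lookup : ∀ {n} (ϑ : Vec Term n) i → Accₘ (lookup ϑ i)
accₜ-lookup : ∀ {n} (ζ : Vec Trail n) i → Accₜ (lookup ζ i)

accₘ one = acc-one
accₘ (lam M) = acc-lam (accₘ M)
accₘ (app M N) = acc-app (accₘ M) (accₘ N)
accₘ (letₘ M N) = acc-let (accₘ M) (accₘ N)
accₘ (bang q M) = acc-bang (accₜ q) (accₘ M)
accₘ (q ▷ M) = acc-▷ (accₜ q) (accₘ M)
accₘ (ins ϑ) = acc-ins-lookup ϑ (accₘ-lookup ϑ)
accₘ (M [ s ]) = acc-[]-≤ (<-wellFounded _) ≤-refl (accₘ M) (accₛ s)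
accₘ (er M) = acc-er (accₘ M)
accₜ r = acc-r
accₜ (t q p) = acc-t (accₜ q) (accₜ p)
accₜ ba = acc-ba
accₜ bb = acc-bb
accₜ ti = acc-ti
accₜ (lamT q) = acc-lamT (accₜ q)
accₜ (appT q p) = acc-appT (accₜ q) (accₜ p)
accₜ (letT q p) = acc-letT (accₜ q) (accₜ p)
accₜ (trT ζ) = acc-trT-lookup ζ (accₜ-lookup ζ)
accₜ (tl M) = acc-tl (accₘ M)
accₛ idₛ = acc-idₛ
accₛ ↑ = acc-↑
accₛ (M ∷ₛ s) = acc-∷ₛ (accₘ M) (accₛ s)
accₛ (s ∘ₛ u) = acc-∘ₛ-≤ (<-wellFounded _) ≤-refl (accₛ s) (accₛ u)
accₘ-lookup (M ∷ ϑ) zero = accₘ M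
accₘ-lookup (M ∷ ϑ) (suc i) = accₘ-lookup ϑ i
accₜ-lookup (q ∷ ζ) zero = accₜ q
accₜ-lookup (q ∷ ζ) (suc i) = accₜ-lookup ζ i

⟶ₘ-sn : StronglyNormalizing _⟶ₘ_
⟶ₘ-sn M = Subrelation.accessible stepₘ (accessible term (acc⇒sn (accₘ M)))

⟶ₜ-sn : StronglyNormalizing _⟶ₜ_
⟶ₜ-sn q = Subrelation.accessible stepₜ (accessible trail (acc⇒sn (accₜ q)))

⟶ₛ-sn : StronglyNormalizing _⟶ₛ_
⟶ₛ-sn s = Subrelation.accessible stepₛ (accessible subs (acc⇒sn (accₛ s)))

Joinable : {A : Set} → (A → A → Set) → A → A → Set
Joinable _⇝_ a b = ∃ λ d → Star _⇝_ a d × Star _⇝_ b d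

infix 4 _↓ₘ_ _↓ₜ_ _↓ₛ_

_↓ₘ_ : Term → Term → Set
_↓ₘ_ = Joinable _⟶ₘ_

_↓ₜ_ : Trail → Trail → Set
_↓ₜ_ = Joinable _⟶ₜ_

_↓ₛ_ : Subst → Subst → Set
_↓ₛ_ = Joinable _⟶ₛ_

module _ {A : Set} {_⇝_ : A → A → Set} where

  ↓-sym : ∀ {a b} → Joinable _⇝_ a b → Joinable _⇝_ b a
  ↓-sym (d , a⇝*d , b⇝*d) = d , b⇝*d , a⇝*d

  join-≡ : ∀ {a b d d'} → Star _⇝_ a d → Star _⇝_ b d' → d ≡ d' → Joinable _⇝_ a b
  join-≡ a⇝*d b⇝*d refl = -, a⇝*d , b⇝*d

  ↓-cong : ∀ {B : Set} {_⇝'_ : B → B → Set} (f : A → B) → (∀ {a b} → a ⇝ b → f a ⇝' f b) →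
           ∀ {a b} → Joinable _⇝_ a b → Joinable _⇝'_ (f a) (f b)
  ↓-cong f f-step (d , a⇝*d , b⇝*d) = f d , gmap f f-step a⇝*d , gmap f f-step b⇝*d

ups-normal : ∀ n {s} → ¬ ups n ⟶ₛ s
ups-normal zero ()
ups-normal (suc zero) (c-compL ())
ups-normal (suc zero) (c-compR ())
ups-normal (suc (suc n)) (c-compL ())
ups-normal (suc (suc n)) (c-compR st) = ups-normal (suc n) st

one[ups]-normal : ∀ n {M} → ¬ one [ ups n ] ⟶ₘ M
one[ups]-normal zero (c-clM ())
one[ups]-normal zero (c-clS ())
one[ups]-normal (suc n) (c-clM ())
one[ups]-normal (suc n) (c-clS st) = ups-normal (suc n) st

replicate-r-normal : ∀ n {ζ} → ¬ replicate n r ⟶ₜᵛ ζ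
replicate-r-normal (suc n) (here ())
replicate-r-normal (suc n) (there st) = replicate-r-normal n st

lookup-map-⇝ : ∀ {A B : Set} {_⇝_ : B → B → Set} (f : A → B) {n} (v : Vec A n) i {x y} →
               lookup v i ≡ x → f x ⇝ y → lookup (map f v) i ⇝ y
lookup-map-⇝ {_⇝_ = _⇝_} f v i refl st = subst (_⇝ _) (sym (lookup-map i f v)) st

lookup-update-⇝ : ∀ {A : Set} {_⇝_ : A → A → Set} {n} (v : Vec A n) i {x y} → x ⇝ y → lookup (v [ i ]≔ x) i ⇝ y
lookup-update-⇝ {_⇝_ = _⇝_} v i {x} st = subst (_⇝ _) (sym (lookup∘update i v x)) st

⟶ₘᵛ-map : ∀ {n} (f : Term → Term) → (∀ {M N} → M ⟶ₘ N → f M ⟶ₘ f N) →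
          {ϑ ϑ' : Vec Term n} → ϑ ⟶ₘᵛ ϑ' → map f ϑ ⟶ₘᵛ map f ϑ'
⟶ₘᵛ-map f f-step (here st) = here (f-step st)
⟶ₘᵛ-map f f-step (there st) = there (⟶ₘᵛ-map f f-step st)

⟶ₘᵛ-map-tl : ∀ {n} {ϑ ϑ' : Vec Term n} → ϑ ⟶ₘᵛ ϑ' → map tl ϑ ⟶ₜᵛ map tl ϑ'
⟶ₘᵛ-map-tl (here st) = here (c-tl st)
⟶ₘᵛ-map-tl (there st) = there (⟶ₘᵛ-map-tl st)

map-⟶ₘᵛ* : ∀ {n} (f g : Term → Term) → (∀ M → Star _⟶ₘ_ (f M) (g M)) →
            (ϑ : Vec Term n) → Star _⟶ₘᵛ_ (map f ϑ) (map g ϑ)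
map-⟶ₘᵛ* f g f⟶*g [] = ε
map-⟶ₘᵛ* f g f⟶*g (M ∷ ϑ) = gmap (_∷ map f ϑ) here (f⟶*g M) ◅◅ gmap (g M ∷_) there (map-⟶ₘᵛ* f g f⟶*g ϑ)

zipWith-t-⟶ₜᵛˡ : ∀ {n} {ζ ζ₁ ζ' : Vec Trail n} → ζ ⟶ₜᵛ ζ₁ → zipWith t ζ ζ' ⟶ₜᵛ zipWith t ζ₁ ζ'
zipWith-t-⟶ₜᵛˡ {ζ' = _ ∷ _} (here st) = here (c-tL st)
zipWith-t-⟶ₜᵛˡ {ζ' = _ ∷ _} (there st) = there (zipWith-t-⟶ₜᵛˡ st)

zipWith-t-⟶ₜᵛʳ : ∀ {n} {ζ ζ' ζ₁ : Vec Trail n} → ζ' ⟶ₜᵛ ζ₁ → zipWith t ζ ζ' ⟶ₜᵛ zipWith t ζ ζ₁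
zipWith-t-⟶ₜᵛʳ {ζ = _ ∷ _} (here st) = here (c-tR st)
zipWith-t-⟶ₜᵛʳ {ζ = _ ∷ _} (there st) = there (zipWith-t-⟶ₜᵛʳ st)

thereᵗ* : ∀ {n q} {ζ ζ' : Vec Trail n} → Star _⟶ₜᵛ_ ζ ζ' → Star _⟶ₜᵛ_ (q ∷ ζ) (q ∷ ζ')
thereᵗ* {q = q} = gmap (q ∷_) there

zipWith-t-rˡ : ∀ {n} (ζ : Vec Trail n) → Star _⟶ₜᵛ_ (zipWith t (replicate n r) ζ) ζ
zipWith-t-rˡ [] = ε
zipWith-t-rˡ (q ∷ ζ) = here τ-rt ◅ thereᵗ* (zipWith-t-rˡ ζ)

zipWith-t-rʳ : ∀ {n} (ζ : Vec Trail n) → Star _⟶ₜᵛ_ (zipWith t ζ (replicate n r)) ζ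
zipWith-t-rʳ [] = ε
zipWith-t-rʳ (q ∷ ζ) = here τ-tr ◅ thereᵗ* (zipWith-t-rʳ ζ)

zipWith-t-assoc : ∀ {n} (ζ₁ ζ₂ ζ₃ : Vec Trail n) →
                  Star _⟶ₜᵛ_ (zipWith t (zipWith t ζ₁ ζ₂) ζ₃) (zipWith t ζ₁ (zipWith t ζ₂ ζ₃))
zipWith-t-assoc [] [] [] = ε
zipWith-t-assoc (_ ∷ ζ₁) (_ ∷ ζ₂) (_ ∷ ζ₃) = here τ-assoc ◅ thereᵗ* (zipWith-t-assoc ζ₁ ζ₂ ζ₃)

zipWith-t-update-rˡ : ∀ {n} (i : Fin n) q p (ζ : Vec Trail n) →
                      Star _⟶ₜᵛ_ (zipWith t (replicate n r [ i ]≔ q) (ζ [ i ]≔ p)) (ζ [ i ]≔ t q p)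
zipWith-t-update-rˡ zero q p (_ ∷ ζ) = thereᵗ* (zipWith-t-rˡ ζ)
zipWith-t-update-rˡ (suc i) q p (_ ∷ ζ) = here τ-rt ◅ thereᵗ* (zipWith-t-update-rˡ i q p ζ)

zipWith-t-update-update : ∀ {n} (i : Fin n) q q' →
  Star _⟶ₜᵛ_ (zipWith t (replicate n r [ i ]≔ q) (replicate n r [ i ]≔ q')) (replicate n r [ i ]≔ t q q')
zipWith-t-update-update {suc n} zero q q' = thereᵗ* (zipWith-t-rˡ (replicate n r))
zipWith-t-update-update {suc n} (suc i) q q' = here τ-rt ◅ thereᵗ* (zipWith-t-update-update i q q')

zipWith-t-update-update′ : ∀ {n} (i j : Fin n) q q' → ¬ i ≡ j →
  Star _⟶ₜᵛ_ (zipWith t (replicate n r [ i ]≔ q) (replicate n r [ j ]≔ q')) ((replicate n r [ i ]≔ q) [ j ]≔ q')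
zipWith-t-update-update′ {suc n} zero zero q q' i≢j = ⊥-elim (i≢j refl)
zipWith-t-update-update′ {suc n} zero (suc j) q q' i≢j = here τ-tr ◅ thereᵗ* (zipWith-t-rˡ (replicate n r [ j ]≔ q'))
zipWith-t-update-update′ {suc n} (suc i) zero q q' i≢j = here τ-rt ◅ thereᵗ* (zipWith-t-rʳ (replicate n r [ i ]≔ q))
zipWith-t-update-update′ {suc n} (suc i) (suc j) q q' i≢j =
  here τ-rt ◅ thereᵗ* (zipWith-t-update-update′ i j q q' (λ i≡j → i≢j (cong suc i≡j)))

[]≔-overwritten : ∀ {A : Set} {n} (v : Vec A n) i {x y z} → (v [ i ]≔ x) [ i ]≔ z ≡ (v [ i ]≔ y) [ i ]≔ z
[]≔-overwritten v i = trans ([]≔-idempotent v i) (sym ([]≔-idempotent v i))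

replicate-r-update-r : ∀ {n} (i : Fin n) → replicate n r [ i ]≔ r ≡ replicate n r
replicate-r-update-r {suc n} zero = refl
replicate-r-update-r {suc n} (suc i) = cong (r ∷_) (replicate-r-update-r i)

c-ins* : ∀ {ϑ ϑ'} → Star _⟶ₘᵛ_ ϑ ϑ' → Star _⟶ₘ_ (ins ϑ) (ins ϑ')
c-ins* = gmap ins c-ins

c-trT* : ∀ {ζ ζ'} → Star _⟶ₜᵛ_ ζ ζ' → Star _⟶ₜ_ (trT ζ) (trT ζ')
c-trT* = gmap trT c-trT

c-tL* : ∀ {q q' p} → Star _⟶ₜ_ q q' → Star _⟶ₜ_ (t q p) (t q' p)
c-tL* {p = p} = gmap (λ q → t q p) c-tL

c-trQ* : ∀ {q q' M} → Star _⟶ₜ_ q q' → Star _⟶ₘ_ (q ▷ M) (q' ▷ M)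
c-trQ* {M = M} = gmap (_▷ M) c-trQ

-- ρ-↓ joins the contractum of the rule ρ with every reduct of its redex.

σ-idl-↓ : ∀ {s B} → idₛ ∘ₛ s ⟶ₛ B → s ↓ₛ B
σ-idl-↓ σ-idl = -, ε , ε
σ-idl-↓ (c-compL ())
σ-idl-↓ (c-compR st) = -, st ◅ ε , σ-idl ◅ ε

σ-shid-↓ : ∀ {B} → ↑ ∘ₛ idₛ ⟶ₛ B → ↑ ↓ₛ B
σ-shid-↓ σ-shid = -, ε , ε
σ-shid-↓ (c-compL ())
σ-shid-↓ (c-compR ())

σ-shcons-↓ : ∀ {M s B} → ↑ ∘ₛ (M ∷ₛ s) ⟶ₛ B → s ↓ₛ B
σ-shcons-↓ σ-shcons = -, ε , ε
σ-shcons-↓ (c-compL ())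
σ-shcons-↓ (c-compR (c-consM st)) = -, ε , σ-shcons ◅ ε
σ-shcons-↓ (c-compR (c-consS st)) = -, st ◅ ε , σ-shcons ◅ ε

σ-map-↓ : ∀ {M s u B} → (M ∷ₛ s) ∘ₛ u ⟶ₛ B → (M [ u ]) ∷ₛ (s ∘ₛ u) ↓ₛ B
σ-map-↓ σ-map = -, ε , ε
σ-map-↓ (c-compL (c-consM st)) = -, c-consM (c-clM st) ◅ ε , σ-map ◅ ε
σ-map-↓ (c-compL (c-consS st)) = -, c-consS (c-compL st) ◅ ε , σ-map ◅ ε
σ-map-↓ (c-compR st) = -, c-consM (c-clS st) ◅ c-consS (c-compR st) ◅ ε , σ-map ◅ ε

σ-assoc-↓ : ∀ {s₁ s₂ s₃ B} → (s₁ ∘ₛ s₂) ∘ₛ s₃ ⟶ₛ B → s₁ ∘ₛ (s₂ ∘ₛ s₃) ↓ₛ B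
σ-assoc-↓ σ-assoc = -, ε , ε
σ-assoc-↓ (c-compL (c-compL st)) = -, c-compL st ◅ ε , σ-assoc ◅ ε
σ-assoc-↓ (c-compL (c-compR st)) = -, c-compR (c-compL st) ◅ ε , σ-assoc ◅ ε
σ-assoc-↓ (c-compR st) = -, c-compR (c-compR st) ◅ ε , σ-assoc ◅ ε
σ-assoc-↓ (c-compL σ-idl) = -, σ-idl ◅ ε , ε
σ-assoc-↓ (c-compL σ-shid) = -, c-compR σ-idl ◅ ε , ε
σ-assoc-↓ (c-compL σ-shcons) = -, c-compR σ-map ◅ σ-shcons ◅ ε , ε
σ-assoc-↓ (c-compL σ-map) = -, σ-map ◅ ε , σ-map ◅ c-consM σ-clos ◅ c-consS σ-assoc ◅ ε
σ-assoc-↓ (c-compL σ-assoc) = -, σ-assoc ◅ ε , σ-assoc ◅ c-compR σ-assoc ◅ ε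

-- Stated with an equation because ups n is not a constructor pattern.
tl-ups-reduct : ∀ {n Z X} → tl Z ⟶ₜ X → Z ≡ one [ ups n ] → X ≡ r
tl-ups-reduct σ-tl1 ()
tl-ups-reduct σ-tlups e = refl
tl-ups-reduct σ-tllam ()
tl-ups-reduct σ-tlapp ()
tl-ups-reduct σ-tlbang ()
tl-ups-reduct σ-tllet ()
tl-ups-reduct σ-tltr ()
tl-ups-reduct σ-tlins ()
tl-ups-reduct {n} (c-tl st) refl = ⊥-elim (one[ups]-normal n st)

σ-tl1-↓ : ∀ {B} → tl one ⟶ₜ B → r ↓ₜ B
σ-tl1-↓ σ-tl1 = -, ε , ε
σ-tl1-↓ (c-tl ())

σ-tlups-↓ : ∀ {n B} → tl (one [ ups n ]) ⟶ₜ B → r ↓ₜ B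
σ-tlups-↓ st = join-≡ ε ε (sym (tl-ups-reduct st refl))

σ-tllam-↓ : ∀ {M B} → tl (lam M) ⟶ₜ B → lamT (tl M) ↓ₜ B
σ-tllam-↓ σ-tllam = -, ε , ε
σ-tllam-↓ (c-tl (c-lam st)) = -, c-lamT (c-tl st) ◅ ε , σ-tllam ◅ ε
σ-tllam-↓ (c-tl τ-lam) = -, c-lamT σ-tltr ◅ ε , σ-tltr ◅ c-tR σ-tllam ◅ τ-lamlam ◅ ε

σ-tlapp-↓ : ∀ {M N B} → tl (app M N) ⟶ₜ B → appT (tl M) (tl N) ↓ₜ B
σ-tlapp-↓ σ-tlapp = -, ε , ε
σ-tlapp-↓ (c-tl (c-appL st)) = -, c-appTL (c-tl st) ◅ ε , σ-tlapp ◅ ε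
σ-tlapp-↓ (c-tl (c-appR st)) = -, c-appTR (c-tl st) ◅ ε , σ-tlapp ◅ ε
σ-tlapp-↓ (c-tl τ-appL) = -, c-appTL σ-tltr ◅ ε , σ-tltr ◅ c-tR σ-tlapp ◅ τ-appapp ◅ c-appTR τ-rt ◅ ε
σ-tlapp-↓ (c-tl τ-appR) = -, c-appTR σ-tltr ◅ ε , σ-tltr ◅ c-tR σ-tlapp ◅ τ-appapp ◅ c-appTL τ-rt ◅ ε

σ-tllet-↓ : ∀ {M N B} → tl (letₘ M N) ⟶ₜ B → letT (tl M) (tl N) ↓ₜ B
σ-tllet-↓ σ-tllet = -, ε , ε
σ-tllet-↓ (c-tl (c-letL st)) = -, c-letTL (c-tl st) ◅ ε , σ-tllet ◅ ε
σ-tllet-↓ (c-tl (c-letR st)) = -, c-letTR (c-tl st) ◅ ε , σ-tllet ◅ ε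
σ-tllet-↓ (c-tl τ-letL) = -, c-letTL σ-tltr ◅ ε , σ-tltr ◅ c-tR σ-tllet ◅ τ-letlet ◅ c-letTR τ-rt ◅ ε
σ-tllet-↓ (c-tl τ-letR) = -, c-letTR σ-tltr ◅ ε , σ-tltr ◅ c-tR σ-tllet ◅ τ-letlet ◅ c-letTL τ-rt ◅ ε

σ-tlbang-↓ : ∀ {q M B} → tl (bang q M) ⟶ₜ B → r ↓ₜ B
σ-tlbang-↓ σ-tlbang = -, ε , ε
σ-tlbang-↓ (c-tl (c-bangQ st)) = -, ε , σ-tlbang ◅ ε
σ-tlbang-↓ (c-tl (c-bangM st)) = -, ε , σ-tlbang ◅ ε
σ-tlbang-↓ (c-tl τ-bang) = -, ε , σ-tlbang ◅ ε

σ-tltr-↓ : ∀ {q M B} → tl (q ▷ M) ⟶ₜ B → t q (tl M) ↓ₜ B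
σ-tltr-↓ σ-tltr = -, ε , ε
σ-tltr-↓ (c-tl (c-trQ st)) = -, c-tL st ◅ ε , σ-tltr ◅ ε
σ-tltr-↓ (c-tl (c-trM st)) = -, c-tR (c-tl st) ◅ ε , σ-tltr ◅ ε
σ-tltr-↓ (c-tl τ-r) = -, τ-rt ◅ ε , ε
σ-tltr-↓ (c-tl τ-tt) = -, c-tR σ-tltr ◅ ε , σ-tltr ◅ τ-assoc ◅ ε

σ-tlins-↓ : ∀ {ϑ B} → tl (ins ϑ) ⟶ₜ B → trT (map tl ϑ) ↓ₜ B
σ-tlins-↓ σ-tlins = -, ε , ε
σ-tlins-↓ (c-tl (c-ins vs)) = -, c-trT (⟶ₘᵛ-map-tl vs) ◅ ε , σ-tlins ◅ ε
σ-tlins-↓ {ϑ} (c-tl (τ-ins {q = q} {M = M} i eq)) =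
  -, c-trT (⟶ₜᵛ-at i (lookup-map-⇝ {_⇝_ = _⟶ₜ_} tl ϑ i eq σ-tltr)) ◅ ε
   , σ-tltr ◅ c-tR σ-tlins ◅ τ-trtr ◅
     c-trT* (subst (λ ζ → Star _⟶ₜᵛ_ (zipWith t (replicate 9 r [ i ]≔ q) ζ) (map tl ϑ [ i ]≔ t q (tl M)))
                   (sym (map-[]≔ tl ϑ i)) (zipWith-t-update-rˡ i q (tl M) (map tl ϑ)))

τ-tr-↓ : ∀ {q B} → t q r ⟶ₜ B → q ↓ₜ B
τ-tr-↓ τ-tr = -, ε , ε
τ-tr-↓ (c-tL st) = -, st ◅ ε , τ-tr ◅ ε
τ-tr-↓ (c-tR ())
τ-tr-↓ τ-rt = -, ε , ε
τ-tr-↓ τ-assoc = -, ε , c-tR τ-tr ◅ ε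

τ-rt-↓ : ∀ {q B} → t r q ⟶ₜ B → q ↓ₜ B
τ-rt-↓ τ-rt = -, ε , ε
τ-rt-↓ (c-tL ())
τ-rt-↓ (c-tR st) = -, st ◅ ε , τ-rt ◅ ε
τ-rt-↓ τ-tr = -, ε , ε

τ-trr-↓ : ∀ {B} → trT (replicate 9 r) ⟶ₜ B → r ↓ₜ B
τ-trr-↓ τ-trr = -, ε , ε
τ-trr-↓ (c-trT vs) = ⊥-elim (replicate-r-normal 9 vs)

τ-apprr-↓ : ∀ {B} → appT r r ⟶ₜ B → r ↓ₜ B
τ-apprr-↓ τ-apprr = -, ε , ε
τ-apprr-↓ (c-appTL ())
τ-apprr-↓ (c-appTR ())

τ-lamr-↓ : ∀ {B} → lamT r ⟶ₜ B → r ↓ₜ B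
τ-lamr-↓ τ-lamr = -, ε , ε
τ-lamr-↓ (c-lamT ())

τ-letrr-↓ : ∀ {B} → letT r r ⟶ₜ B → r ↓ₜ B
τ-letrr-↓ τ-letrr = -, ε , ε
τ-letrr-↓ (c-letTL ())
τ-letrr-↓ (c-letTR ())

τ-assoc-↓ : ∀ {q₁ q₂ q₃ B} → t (t q₁ q₂) q₃ ⟶ₜ B → t q₁ (t q₂ q₃) ↓ₜ B
τ-assoc-↓ τ-assoc = -, ε , ε
τ-assoc-↓ (c-tL (c-tL st)) = -, c-tL st ◅ ε , τ-assoc ◅ ε
τ-assoc-↓ (c-tL (c-tR st)) = -, c-tR (c-tL st) ◅ ε , τ-assoc ◅ ε
τ-assoc-↓ (c-tR st) = -, c-tR (c-tR st) ◅ ε , τ-assoc ◅ ε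
τ-assoc-↓ (c-tL τ-tr) = -, c-tR τ-rt ◅ ε , ε
τ-assoc-↓ (c-tL τ-rt) = -, τ-rt ◅ ε , ε
τ-assoc-↓ (c-tL τ-assoc) = -, τ-assoc ◅ ε , τ-assoc ◅ c-tR τ-assoc ◅ ε
τ-assoc-↓ (c-tL τ-lamlam) = -, τ-lamlam' ◅ ε , ε
τ-assoc-↓ (c-tL τ-lamlam') = -, c-tR τ-assoc ◅ τ-lamlam' ◅ ε , τ-assoc ◅ ε
τ-assoc-↓ (c-tL τ-appapp) = -, τ-appapp' ◅ ε , ε
τ-assoc-↓ (c-tL τ-appapp') = -, c-tR τ-assoc ◅ τ-appapp' ◅ ε , τ-assoc ◅ ε
τ-assoc-↓ (c-tL τ-letlet) = -, τ-letlet' ◅ ε , ε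
τ-assoc-↓ (c-tL τ-letlet') = -, c-tR τ-assoc ◅ τ-letlet' ◅ ε , τ-assoc ◅ ε
τ-assoc-↓ (c-tL τ-trtr) = -, τ-trtr' ◅ ε , ε
τ-assoc-↓ (c-tL τ-trtr') = -, c-tR τ-assoc ◅ τ-trtr' ◅ ε , τ-assoc ◅ ε
τ-assoc-↓ τ-tr = -, c-tR τ-tr ◅ ε , ε

τ-lamlam-↓ : ∀ {a b B} → t (lamT a) (lamT b) ⟶ₜ B → lamT (t a b) ↓ₜ B
τ-lamlam-↓ τ-lamlam = -, ε , ε
τ-lamlam-↓ (c-tL (c-lamT st)) = -, c-lamT (c-tL st) ◅ ε , τ-lamlam ◅ ε
τ-lamlam-↓ (c-tL τ-lamr) = -, c-lamT τ-rt ◅ ε , τ-rt ◅ ε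
τ-lamlam-↓ (c-tR (c-lamT st)) = -, c-lamT (c-tR st) ◅ ε , τ-lamlam ◅ ε
τ-lamlam-↓ (c-tR τ-lamr) = -, c-lamT τ-tr ◅ ε , τ-tr ◅ ε

τ-lamlam'-↓ : ∀ {a b q B} → t (lamT a) (t (lamT b) q) ⟶ₜ B → t (lamT (t a b)) q ↓ₜ B
τ-lamlam'-↓ τ-lamlam' = -, ε , ε
τ-lamlam'-↓ (c-tL (c-lamT st)) = -, c-tL (c-lamT (c-tL st)) ◅ ε , τ-lamlam' ◅ ε
τ-lamlam'-↓ (c-tL τ-lamr) = -, c-tL (c-lamT τ-rt) ◅ ε , τ-rt ◅ ε
τ-lamlam'-↓ (c-tR (c-tL (c-lamT st))) = -, c-tL (c-lamT (c-tR st)) ◅ ε , τ-lamlam' ◅ ε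
τ-lamlam'-↓ (c-tR (c-tL τ-lamr)) = -, c-tL (c-lamT τ-tr) ◅ ε , c-tR τ-rt ◅ ε
τ-lamlam'-↓ (c-tR (c-tR st)) = -, c-tR st ◅ ε , τ-lamlam' ◅ ε
τ-lamlam'-↓ (c-tR τ-tr) = -, τ-tr ◅ ε , τ-lamlam ◅ ε
τ-lamlam'-↓ (c-tR τ-lamlam) = -, τ-lamlam ◅ c-lamT τ-assoc ◅ ε , τ-lamlam ◅ ε
τ-lamlam'-↓ (c-tR τ-lamlam') = -, τ-lamlam' ◅ c-tL (c-lamT τ-assoc) ◅ ε , τ-lamlam' ◅ ε

τ-appapp-↓ : ∀ {a₁ a₂ b₁ b₂ B} → t (appT a₁ a₂) (appT b₁ b₂) ⟶ₜ B → appT (t a₁ b₁) (t a₂ b₂) ↓ₜ B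
τ-appapp-↓ τ-appapp = -, ε , ε
τ-appapp-↓ (c-tL (c-appTL st)) = -, c-appTL (c-tL st) ◅ ε , τ-appapp ◅ ε
τ-appapp-↓ (c-tL (c-appTR st)) = -, c-appTR (c-tL st) ◅ ε , τ-appapp ◅ ε
τ-appapp-↓ (c-tL τ-apprr) = -, c-appTL τ-rt ◅ c-appTR τ-rt ◅ ε , τ-rt ◅ ε
τ-appapp-↓ (c-tR (c-appTL st)) = -, c-appTL (c-tR st) ◅ ε , τ-appapp ◅ ε
τ-appapp-↓ (c-tR (c-appTR st)) = -, c-appTR (c-tR st) ◅ ε , τ-appapp ◅ ε
τ-appapp-↓ (c-tR τ-apprr) = -, c-appTL τ-tr ◅ c-appTR τ-tr ◅ ε , τ-tr ◅ ε

τ-appapp'-↓ : ∀ {a₁ a₂ b₁ b₂ q B} → t (appT a₁ a₂) (t (appT b₁ b₂) q) ⟶ₜ B →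
              t (appT (t a₁ b₁) (t a₂ b₂)) q ↓ₜ B
τ-appapp'-↓ τ-appapp' = -, ε , ε
τ-appapp'-↓ (c-tL (c-appTL st)) = -, c-tL (c-appTL (c-tL st)) ◅ ε , τ-appapp' ◅ ε
τ-appapp'-↓ (c-tL (c-appTR st)) = -, c-tL (c-appTR (c-tL st)) ◅ ε , τ-appapp' ◅ ε
τ-appapp'-↓ (c-tL τ-apprr) = -, c-tL (c-appTL τ-rt) ◅ c-tL (c-appTR τ-rt) ◅ ε , τ-rt ◅ ε
τ-appapp'-↓ (c-tR (c-tL (c-appTL st))) = -, c-tL (c-appTL (c-tR st)) ◅ ε , τ-appapp' ◅ ε
τ-appapp'-↓ (c-tR (c-tL (c-appTR st))) = -, c-tL (c-appTR (c-tR st)) ◅ ε , τ-appapp' ◅ ε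
τ-appapp'-↓ (c-tR (c-tL τ-apprr)) = -, c-tL (c-appTL τ-tr) ◅ c-tL (c-appTR τ-tr) ◅ ε , c-tR τ-rt ◅ ε
τ-appapp'-↓ (c-tR (c-tR st)) = -, c-tR st ◅ ε , τ-appapp' ◅ ε
τ-appapp'-↓ (c-tR τ-tr) = -, τ-tr ◅ ε , τ-appapp ◅ ε
τ-appapp'-↓ (c-tR τ-appapp) = -, τ-appapp ◅ c-appTL τ-assoc ◅ c-appTR τ-assoc ◅ ε , τ-appapp ◅ ε
τ-appapp'-↓ (c-tR τ-appapp') = -, τ-appapp' ◅ c-tL (c-appTL τ-assoc) ◅ c-tL (c-appTR τ-assoc) ◅ ε , τ-appapp' ◅ ε

τ-letlet-↓ : ∀ {a₁ a₂ b₁ b₂ B} → t (letT a₁ a₂) (letT b₁ b₂) ⟶ₜ B → letT (t a₁ b₁) (t a₂ b₂) ↓ₜ B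
τ-letlet-↓ τ-letlet = -, ε , ε
τ-letlet-↓ (c-tL (c-letTL st)) = -, c-letTL (c-tL st) ◅ ε , τ-letlet ◅ ε
τ-letlet-↓ (c-tL (c-letTR st)) = -, c-letTR (c-tL st) ◅ ε , τ-letlet ◅ ε
τ-letlet-↓ (c-tL τ-letrr) = -, c-letTL τ-rt ◅ c-letTR τ-rt ◅ ε , τ-rt ◅ ε
τ-letlet-↓ (c-tR (c-letTL st)) = -, c-letTL (c-tR st) ◅ ε , τ-letlet ◅ ε
τ-letlet-↓ (c-tR (c-letTR st)) = -, c-letTR (c-tR st) ◅ ε , τ-letlet ◅ ε
τ-letlet-↓ (c-tR τ-letrr) = -, c-letTL τ-tr ◅ c-letTR τ-tr ◅ ε , τ-tr ◅ ε

τ-letlet'-↓ : ∀ {a₁ a₂ b₁ b₂ q B} → t (letT a₁ a₂) (t (letT b₁ b₂) q) ⟶ₜ B →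
              t (letT (t a₁ b₁) (t a₂ b₂)) q ↓ₜ B
τ-letlet'-↓ τ-letlet' = -, ε , ε
τ-letlet'-↓ (c-tL (c-letTL st)) = -, c-tL (c-letTL (c-tL st)) ◅ ε , τ-letlet' ◅ ε
τ-letlet'-↓ (c-tL (c-letTR st)) = -, c-tL (c-letTR (c-tL st)) ◅ ε , τ-letlet' ◅ ε
τ-letlet'-↓ (c-tL τ-letrr) = -, c-tL (c-letTL τ-rt) ◅ c-tL (c-letTR τ-rt) ◅ ε , τ-rt ◅ ε
τ-letlet'-↓ (c-tR (c-tL (c-letTL st))) = -, c-tL (c-letTL (c-tR st)) ◅ ε , τ-letlet' ◅ ε
τ-letlet'-↓ (c-tR (c-tL (c-letTR st))) = -, c-tL (c-letTR (c-tR st)) ◅ ε , τ-letlet' ◅ ε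
τ-letlet'-↓ (c-tR (c-tL τ-letrr)) = -, c-tL (c-letTL τ-tr) ◅ c-tL (c-letTR τ-tr) ◅ ε , c-tR τ-rt ◅ ε
τ-letlet'-↓ (c-tR (c-tR st)) = -, c-tR st ◅ ε , τ-letlet' ◅ ε
τ-letlet'-↓ (c-tR τ-tr) = -, τ-tr ◅ ε , τ-letlet ◅ ε
τ-letlet'-↓ (c-tR τ-letlet) = -, τ-letlet ◅ c-letTL τ-assoc ◅ c-letTR τ-assoc ◅ ε , τ-letlet ◅ ε
τ-letlet'-↓ (c-tR τ-letlet') = -, τ-letlet' ◅ c-tL (c-letTL τ-assoc) ◅ c-tL (c-letTR τ-assoc) ◅ ε , τ-letlet' ◅ ε

τ-trtr-↓ : ∀ {ζ ζ' B} → t (trT ζ) (trT ζ') ⟶ₜ B → trT (zipWith t ζ ζ') ↓ₜ B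
τ-trtr-↓ τ-trtr = -, ε , ε
τ-trtr-↓ (c-tL (c-trT vs)) = -, c-trT (zipWith-t-⟶ₜᵛˡ vs) ◅ ε , τ-trtr ◅ ε
τ-trtr-↓ {ζ' = ζ'} (c-tL τ-trr) = -, c-trT* (zipWith-t-rˡ ζ') , τ-rt ◅ ε
τ-trtr-↓ (c-tR (c-trT vs)) = -, c-trT (zipWith-t-⟶ₜᵛʳ vs) ◅ ε , τ-trtr ◅ ε
τ-trtr-↓ {ζ = ζ} (c-tR τ-trr) = -, c-trT* (zipWith-t-rʳ ζ) , τ-tr ◅ ε

τ-trtr'-↓ : ∀ {ζ ζ' q B} → t (trT ζ) (t (trT ζ') q) ⟶ₜ B → t (trT (zipWith t ζ ζ')) q ↓ₜ B
τ-trtr'-↓ τ-trtr' = -, ε , ε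
τ-trtr'-↓ (c-tL (c-trT vs)) = -, c-tL (c-trT (zipWith-t-⟶ₜᵛˡ vs)) ◅ ε , τ-trtr' ◅ ε
τ-trtr'-↓ {ζ' = ζ'} (c-tL τ-trr) = -, c-tL* (c-trT* (zipWith-t-rˡ ζ')) , τ-rt ◅ ε
τ-trtr'-↓ (c-tR (c-tL (c-trT vs))) = -, c-tL (c-trT (zipWith-t-⟶ₜᵛʳ vs)) ◅ ε , τ-trtr' ◅ ε
τ-trtr'-↓ {ζ = ζ} (c-tR (c-tL τ-trr)) = -, c-tL* (c-trT* (zipWith-t-rʳ ζ)) , c-tR τ-rt ◅ ε
τ-trtr'-↓ (c-tR (c-tR st)) = -, c-tR st ◅ ε , τ-trtr' ◅ ε
τ-trtr'-↓ (c-tR τ-tr) = -, τ-tr ◅ ε , τ-trtr ◅ ε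
τ-trtr'-↓ {ζ} {ζ'} (c-tR (τ-trtr {ζ' = ζ''})) = -, τ-trtr ◅ c-trT* (zipWith-t-assoc ζ ζ' ζ'') , τ-trtr ◅ ε
τ-trtr'-↓ {ζ} {ζ'} (c-tR (τ-trtr' {ζ' = ζ''})) = -, τ-trtr' ◅ c-tL* (c-trT* (zipWith-t-assoc ζ ζ' ζ'')) , τ-trtr' ◅ ε


σ-id-↓ : ∀ {B} → one [ idₛ ] ⟶ₘ B → one ↓ₘ B
σ-id-↓ σ-id = -, ε , ε
σ-id-↓ (c-clM ())
σ-id-↓ (c-clS ())

σ-cons-↓ : ∀ {M s B} → one [ M ∷ₛ s ] ⟶ₘ B → M ↓ₘ B
σ-cons-↓ σ-cons = -, ε , ε
σ-cons-↓ (c-clM ())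
σ-cons-↓ (c-clS (c-consM st)) = -, st ◅ ε , σ-cons ◅ ε
σ-cons-↓ (c-clS (c-consS st)) = -, ε , σ-cons ◅ ε

σ-lam-↓ : ∀ {M s B} → lam M [ s ] ⟶ₘ B → lam (M [ one ∷ₛ (s ∘ₛ ↑) ]) ↓ₘ B
σ-lam-↓ σ-lam = -, ε , ε
σ-lam-↓ (c-clM (c-lam st)) = -, c-lam (c-clM st) ◅ ε , σ-lam ◅ ε
σ-lam-↓ (c-clM τ-lam) = -, c-lam σ-tr ◅ τ-lam ◅ ε , σ-tr ◅ c-trM σ-lam ◅ ε
σ-lam-↓ (c-clS st) = -, c-lam (c-clS (c-consS (c-compL st))) ◅ ε , σ-lam ◅ ε

σ-app-↓ : ∀ {M N s B} → app M N [ s ] ⟶ₘ B → app (M [ s ]) (N [ s ]) ↓ₘ B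
σ-app-↓ σ-app = -, ε , ε
σ-app-↓ (c-clM (c-appL st)) = -, c-appL (c-clM st) ◅ ε , σ-app ◅ ε
σ-app-↓ (c-clM (c-appR st)) = -, c-appR (c-clM st) ◅ ε , σ-app ◅ ε
σ-app-↓ (c-clM τ-appL) = -, c-appL σ-tr ◅ τ-appL ◅ ε , σ-tr ◅ c-trM σ-app ◅ ε
σ-app-↓ (c-clM τ-appR) = -, c-appR σ-tr ◅ τ-appR ◅ ε , σ-tr ◅ c-trM σ-app ◅ ε
σ-app-↓ (c-clS st) = -, c-appL (c-clS st) ◅ c-appR (c-clS st) ◅ ε , σ-app ◅ ε

σ-bang-↓ : ∀ {q M s B} → bang q M [ s ] ⟶ₘ B → bang q (M [ s ]) ↓ₘ B
σ-bang-↓ σ-bang = -, ε , ε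
σ-bang-↓ (c-clM (c-bangQ st)) = -, c-bangQ st ◅ ε , σ-bang ◅ ε
σ-bang-↓ (c-clM (c-bangM st)) = -, c-bangM (c-clM st) ◅ ε , σ-bang ◅ ε
σ-bang-↓ (c-clM τ-bang) = -, c-bangM σ-tr ◅ τ-bang ◅ ε , σ-bang ◅ ε
σ-bang-↓ (c-clS st) = -, c-bangM (c-clS st) ◅ ε , σ-bang ◅ ε

σ-let-↓ : ∀ {M N s B} → letₘ M N [ s ] ⟶ₘ B → letₘ (M [ s ]) (N [ one ∷ₛ (s ∘ₛ ↑) ]) ↓ₘ B
σ-let-↓ σ-let = -, ε , ε
σ-let-↓ (c-clM (c-letL st)) = -, c-letL (c-clM st) ◅ ε , σ-let ◅ ε
σ-let-↓ (c-clM (c-letR st)) = -, c-letR (c-clM st) ◅ ε , σ-let ◅ ε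
σ-let-↓ (c-clM τ-letL) = -, c-letL σ-tr ◅ τ-letL ◅ ε , σ-tr ◅ c-trM σ-let ◅ ε
σ-let-↓ (c-clM τ-letR) = -, c-letR σ-tr ◅ τ-letR ◅ ε , σ-tr ◅ c-trM σ-let ◅ ε
σ-let-↓ (c-clS st) = -, c-letL (c-clS st) ◅ c-letR (c-clS (c-consS (c-compL st))) ◅ ε , σ-let ◅ ε

σ-tr-↓ : ∀ {q M s B} → (q ▷ M) [ s ] ⟶ₘ B → q ▷ (M [ s ]) ↓ₘ B
σ-tr-↓ σ-tr = -, ε , ε
σ-tr-↓ (c-clM (c-trQ st)) = -, c-trQ st ◅ ε , σ-tr ◅ ε
σ-tr-↓ (c-clM (c-trM st)) = -, c-trM (c-clM st) ◅ ε , σ-tr ◅ ε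
σ-tr-↓ (c-clM τ-r) = -, τ-r ◅ ε , ε
σ-tr-↓ (c-clM τ-tt) = -, c-trM σ-tr ◅ τ-tt ◅ ε , σ-tr ◅ ε
σ-tr-↓ (c-clS st) = -, c-trM (c-clS st) ◅ ε , σ-tr ◅ ε

σ-ins-↓ : ∀ {ϑ s B} → ins ϑ [ s ] ⟶ₘ B → ins (map (_[ s ]) ϑ) ↓ₘ B
σ-ins-↓ σ-ins = -, ε , ε
σ-ins-↓ {s = s} (c-clM (c-ins vs)) = -, c-ins (⟶ₘᵛ-map (_[ s ]) c-clM vs) ◅ ε , σ-ins ◅ ε
σ-ins-↓ {ϑ} {s} (c-clM (τ-ins {q = q} {M = M} i eq)) =
  join-≡ (c-ins (⟶ₘᵛ-at i (lookup-map-⇝ {_⇝_ = _⟶ₘ_} (_[ s ]) ϑ i eq σ-tr)) ◅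
            τ-ins i (lookup∘update i (map (_[ s ]) ϑ) _) ◅ ε)
         (σ-tr ◅ c-trM σ-ins ◅ ε)
         (cong (λ ϑ' → trT (replicate 9 r [ i ]≔ q) ▷ ins ϑ')
               (trans ([]≔-idempotent (map (_[ s ]) ϑ) i) (sym (map-[]≔ (_[ s ]) ϑ i))))
σ-ins-↓ {ϑ} {s} (c-clS {s' = s'} st) = -, c-ins* (map-⟶ₘᵛ* (_[ s ]) (_[ s' ]) (λ _ → c-clS st ◅ ε) ϑ) , σ-ins ◅ ε

σ-clos-↓ : ∀ {M s s' B} → M [ s ] [ s' ] ⟶ₘ B → M [ s ∘ₛ s' ] ↓ₘ B
σ-clos-↓ σ-clos = -, ε , ε
σ-clos-↓ (c-clS st) = -, c-clS (c-compR st) ◅ ε , σ-clos ◅ ε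
σ-clos-↓ (c-clM (c-clM st)) = -, c-clM st ◅ ε , σ-clos ◅ ε
σ-clos-↓ (c-clM (c-clS st)) = -, c-clS (c-compL st) ◅ ε , σ-clos ◅ ε
σ-clos-↓ (c-clM σ-id) = -, c-clS σ-idl ◅ ε , ε
σ-clos-↓ (c-clM σ-cons) = -, c-clS σ-map ◅ σ-cons ◅ ε , ε
σ-clos-↓ (c-clM σ-lam) =
  -, σ-lam ◅ c-lam (c-clS (c-consS σ-assoc)) ◅ ε
   , σ-lam ◅ c-lam σ-clos ◅ c-lam (c-clS σ-map) ◅ c-lam (c-clS (c-consM σ-cons)) ◅
     c-lam (c-clS (c-consS σ-assoc)) ◅ c-lam (c-clS (c-consS (c-compR σ-shcons))) ◅ ε
σ-clos-↓ (c-clM σ-app) = -, σ-app ◅ ε , σ-app ◅ c-appL σ-clos ◅ c-appR σ-clos ◅ ε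
σ-clos-↓ (c-clM σ-bang) = -, σ-bang ◅ ε , σ-bang ◅ c-bangM σ-clos ◅ ε
σ-clos-↓ (c-clM σ-let) =
  -, σ-let ◅ c-letR (c-clS (c-consS σ-assoc)) ◅ ε
   , σ-let ◅ c-letL σ-clos ◅ c-letR σ-clos ◅ c-letR (c-clS σ-map) ◅ c-letR (c-clS (c-consM σ-cons)) ◅
     c-letR (c-clS (c-consS σ-assoc)) ◅ c-letR (c-clS (c-consS (c-compR σ-shcons))) ◅ ε
σ-clos-↓ (c-clM σ-tr) = -, σ-tr ◅ ε , σ-tr ◅ c-trM σ-clos ◅ ε
σ-clos-↓ {s = s} {s'} (c-clM (σ-ins {ϑ})) =
  -, σ-ins ◅ ε ,
     σ-ins ◅ c-ins* (subst (λ ϑ' → Star _⟶ₘᵛ_ ϑ' (map (_[ s ∘ₛ s' ]) ϑ)) (map-∘ (_[ s' ]) (_[ s ]) ϑ)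
                       (map-⟶ₘᵛ* (λ M → M [ s ] [ s' ]) (_[ s ∘ₛ s' ]) (λ _ → σ-clos ◅ ε) ϑ))
σ-clos-↓ (c-clM σ-clos) = -, σ-clos ◅ ε , σ-clos ◅ c-clS σ-assoc ◅ ε

σ-er1-↓ : ∀ {B} → er one ⟶ₘ B → one ↓ₘ B
σ-er1-↓ σ-er1 = -, ε , ε
σ-er1-↓ (c-er ())

er-ups-reduct : ∀ {n Z X} → er Z ⟶ₘ X → Z ≡ one [ ups n ] → X ≡ one [ ups n ]
er-ups-reduct σ-er1 ()
er-ups-reduct σ-erups e = e
er-ups-reduct σ-erlam ()
er-ups-reduct σ-erapp ()
er-ups-reduct σ-erbang ()
er-ups-reduct σ-erlet ()
er-ups-reduct σ-ertr ()
er-ups-reduct σ-erins ()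
er-ups-reduct {n} (c-er st) refl = ⊥-elim (one[ups]-normal n st)

σ-erups-↓ : ∀ {n B} → er (one [ ups n ]) ⟶ₘ B → one [ ups n ] ↓ₘ B
σ-erups-↓ st = join-≡ ε ε (sym (er-ups-reduct st refl))

σ-erlam-↓ : ∀ {M B} → er (lam M) ⟶ₘ B → lam (er M) ↓ₘ B
σ-erlam-↓ σ-erlam = -, ε , ε
σ-erlam-↓ (c-er (c-lam st)) = -, c-lam (c-er st) ◅ ε , σ-erlam ◅ ε
σ-erlam-↓ (c-er τ-lam) = -, c-lam σ-ertr ◅ ε , σ-ertr ◅ σ-erlam ◅ ε

σ-erapp-↓ : ∀ {M N B} → er (app M N) ⟶ₘ B → app (er M) (er N) ↓ₘ B
σ-erapp-↓ σ-erapp = -, ε , ε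
σ-erapp-↓ (c-er (c-appL st)) = -, c-appL (c-er st) ◅ ε , σ-erapp ◅ ε
σ-erapp-↓ (c-er (c-appR st)) = -, c-appR (c-er st) ◅ ε , σ-erapp ◅ ε
σ-erapp-↓ (c-er τ-appL) = -, c-appL σ-ertr ◅ ε , σ-ertr ◅ σ-erapp ◅ ε
σ-erapp-↓ (c-er τ-appR) = -, c-appR σ-ertr ◅ ε , σ-ertr ◅ σ-erapp ◅ ε

σ-erlet-↓ : ∀ {M N B} → er (letₘ M N) ⟶ₘ B → letₘ (er M) (er N) ↓ₘ B
σ-erlet-↓ σ-erlet = -, ε , ε
σ-erlet-↓ (c-er (c-letL st)) = -, c-letL (c-er st) ◅ ε , σ-erlet ◅ ε
σ-erlet-↓ (c-er (c-letR st)) = -, c-letR (c-er st) ◅ ε , σ-erlet ◅ ε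
σ-erlet-↓ (c-er τ-letL) = -, c-letL σ-ertr ◅ ε , σ-ertr ◅ σ-erlet ◅ ε
σ-erlet-↓ (c-er τ-letR) = -, c-letR σ-ertr ◅ ε , σ-ertr ◅ σ-erlet ◅ ε

σ-erbang-↓ : ∀ {q M B} → er (bang q M) ⟶ₘ B → bang q M ↓ₘ B
σ-erbang-↓ σ-erbang = -, ε , ε
σ-erbang-↓ (c-er (c-bangQ st)) = -, c-bangQ st ◅ ε , σ-erbang ◅ ε
σ-erbang-↓ (c-er (c-bangM st)) = -, c-bangM st ◅ ε , σ-erbang ◅ ε
σ-erbang-↓ (c-er τ-bang) = -, τ-bang ◅ ε , σ-erbang ◅ ε

σ-ertr-↓ : ∀ {q M B} → er (q ▷ M) ⟶ₘ B → er M ↓ₘ B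
σ-ertr-↓ σ-ertr = -, ε , ε
σ-ertr-↓ (c-er (c-trQ st)) = -, ε , σ-ertr ◅ ε
σ-ertr-↓ (c-er (c-trM st)) = -, c-er st ◅ ε , σ-ertr ◅ ε
σ-ertr-↓ (c-er τ-r) = -, ε , ε
σ-ertr-↓ (c-er τ-tt) = -, σ-ertr ◅ ε , σ-ertr ◅ ε

σ-erins-↓ : ∀ {ϑ B} → er (ins ϑ) ⟶ₘ B → ins (map er ϑ) ↓ₘ B
σ-erins-↓ σ-erins = -, ε , ε
σ-erins-↓ (c-er (c-ins vs)) = -, c-ins (⟶ₘᵛ-map er c-er vs) ◅ ε , σ-erins ◅ ε
σ-erins-↓ {ϑ} (c-er (τ-ins {q = q} {M = M} i eq)) =
  join-≡ (c-ins (⟶ₘᵛ-at i (lookup-map-⇝ {_⇝_ = _⟶ₘ_} er ϑ i eq σ-ertr)) ◅ ε) (σ-ertr ◅ σ-erins ◅ ε)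
         (cong ins (sym (map-[]≔ er ϑ i)))

τ-r-↓ : ∀ {M B} → r ▷ M ⟶ₘ B → M ↓ₘ B
τ-r-↓ τ-r = -, ε , ε
τ-r-↓ (c-trQ ())
τ-r-↓ (c-trM st) = -, st ◅ ε , τ-r ◅ ε
τ-r-↓ τ-tt = -, ε , c-trQ τ-rt ◅ ε

τ-tt-↓ : ∀ {q q' M B} → q ▷ (q' ▷ M) ⟶ₘ B → t q q' ▷ M ↓ₘ B
τ-tt-↓ τ-tt = -, ε , ε
τ-tt-↓ (c-trQ st) = -, c-trQ (c-tL st) ◅ ε , τ-tt ◅ ε
τ-tt-↓ (c-trM (c-trQ st)) = -, c-trQ (c-tR st) ◅ ε , τ-tt ◅ ε
τ-tt-↓ (c-trM (c-trM st)) = -, c-trM st ◅ ε , τ-tt ◅ ε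
τ-tt-↓ (c-trM τ-r) = -, c-trQ τ-tr ◅ ε , ε
τ-tt-↓ (c-trM τ-tt) = -, τ-tt ◅ c-trQ τ-assoc ◅ ε , τ-tt ◅ ε
τ-tt-↓ τ-r = -, c-trQ τ-rt ◅ ε , ε

τ-bang-↓ : ∀ {q q' M B} → bang q (q' ▷ M) ⟶ₘ B → bang (t q q') M ↓ₘ B
τ-bang-↓ τ-bang = -, ε , ε
τ-bang-↓ (c-bangQ st) = -, c-bangQ (c-tL st) ◅ ε , τ-bang ◅ ε
τ-bang-↓ (c-bangM (c-trQ st)) = -, c-bangQ (c-tR st) ◅ ε , τ-bang ◅ ε
τ-bang-↓ (c-bangM (c-trM st)) = -, c-bangM st ◅ ε , τ-bang ◅ ε
τ-bang-↓ (c-bangM τ-r) = -, c-bangQ τ-tr ◅ ε , ε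
τ-bang-↓ (c-bangM τ-tt) = -, τ-bang ◅ c-bangQ τ-assoc ◅ ε , τ-bang ◅ ε

τ-lam-↓ : ∀ {q M B} → lam (q ▷ M) ⟶ₘ B → lamT q ▷ lam M ↓ₘ B
τ-lam-↓ τ-lam = -, ε , ε
τ-lam-↓ (c-lam (c-trQ st)) = -, c-trQ (c-lamT st) ◅ ε , τ-lam ◅ ε
τ-lam-↓ (c-lam (c-trM st)) = -, c-trM (c-lam st) ◅ ε , τ-lam ◅ ε
τ-lam-↓ (c-lam τ-r) = -, c-trQ τ-lamr ◅ τ-r ◅ ε , ε
τ-lam-↓ (c-lam τ-tt) = -, c-trM τ-lam ◅ τ-tt ◅ c-trQ τ-lamlam ◅ ε , τ-lam ◅ ε

τ-appL-↓ : ∀ {q M N B} → app (q ▷ M) N ⟶ₘ B → appT q r ▷ app M N ↓ₘ B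
τ-appL-↓ τ-appL = -, ε , ε
τ-appL-↓ (c-appL (c-trQ st)) = -, c-trQ (c-appTL st) ◅ ε , τ-appL ◅ ε
τ-appL-↓ (c-appL (c-trM st)) = -, c-trM (c-appL st) ◅ ε , τ-appL ◅ ε
τ-appL-↓ (c-appL τ-r) = -, c-trQ τ-apprr ◅ τ-r ◅ ε , ε
τ-appL-↓ (c-appL τ-tt) = -, c-trM τ-appL ◅ τ-tt ◅ c-trQ τ-appapp ◅ c-trQ (c-appTR τ-tr) ◅ ε , τ-appL ◅ ε
τ-appL-↓ (c-appR st) = -, c-trM (c-appR st) ◅ ε , τ-appL ◅ ε
τ-appL-↓ τ-appR =
  -, c-trM τ-appR ◅ τ-tt ◅ c-trQ τ-appapp ◅ c-trQ (c-appTL τ-tr) ◅ c-trQ (c-appTR τ-rt) ◅ ε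
   , c-trM τ-appL ◅ τ-tt ◅ c-trQ τ-appapp ◅ c-trQ (c-appTL τ-rt) ◅ c-trQ (c-appTR τ-tr) ◅ ε

τ-appR-↓ : ∀ {q M N B} → app M (q ▷ N) ⟶ₘ B → appT r q ▷ app M N ↓ₘ B
τ-appR-↓ τ-appR = -, ε , ε
τ-appR-↓ (c-appR (c-trQ st)) = -, c-trQ (c-appTR st) ◅ ε , τ-appR ◅ ε
τ-appR-↓ (c-appR (c-trM st)) = -, c-trM (c-appR st) ◅ ε , τ-appR ◅ ε
τ-appR-↓ (c-appR τ-r) = -, c-trQ τ-apprr ◅ τ-r ◅ ε , ε
τ-appR-↓ (c-appR τ-tt) = -, c-trM τ-appR ◅ τ-tt ◅ c-trQ τ-appapp ◅ c-trQ (c-appTL τ-tr) ◅ ε , τ-appR ◅ ε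
τ-appR-↓ (c-appL st) = -, c-trM (c-appL st) ◅ ε , τ-appR ◅ ε
τ-appR-↓ τ-appL = ↓-sym (τ-appL-↓ τ-appR)

τ-letL-↓ : ∀ {q M N B} → letₘ (q ▷ M) N ⟶ₘ B → letT q r ▷ letₘ M N ↓ₘ B
τ-letL-↓ τ-letL = -, ε , ε
τ-letL-↓ (c-letL (c-trQ st)) = -, c-trQ (c-letTL st) ◅ ε , τ-letL ◅ ε
τ-letL-↓ (c-letL (c-trM st)) = -, c-trM (c-letL st) ◅ ε , τ-letL ◅ ε
τ-letL-↓ (c-letL τ-r) = -, c-trQ τ-letrr ◅ τ-r ◅ ε , ε
τ-letL-↓ (c-letL τ-tt) = -, c-trM τ-letL ◅ τ-tt ◅ c-trQ τ-letlet ◅ c-trQ (c-letTR τ-tr) ◅ ε , τ-letL ◅ ε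
τ-letL-↓ (c-letR st) = -, c-trM (c-letR st) ◅ ε , τ-letL ◅ ε
τ-letL-↓ τ-letR =
  -, c-trM τ-letR ◅ τ-tt ◅ c-trQ τ-letlet ◅ c-trQ (c-letTL τ-tr) ◅ c-trQ (c-letTR τ-rt) ◅ ε
   , c-trM τ-letL ◅ τ-tt ◅ c-trQ τ-letlet ◅ c-trQ (c-letTL τ-rt) ◅ c-trQ (c-letTR τ-tr) ◅ ε

τ-letR-↓ : ∀ {q M N B} → letₘ M (q ▷ N) ⟶ₘ B → letT r q ▷ letₘ M N ↓ₘ B
τ-letR-↓ τ-letR = -, ε , ε
τ-letR-↓ (c-letR (c-trQ st)) = -, c-trQ (c-letTR st) ◅ ε , τ-letR ◅ ε
τ-letR-↓ (c-letR (c-trM st)) = -, c-trM (c-letR st) ◅ ε , τ-letR ◅ ε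
τ-letR-↓ (c-letR τ-r) = -, c-trQ τ-letrr ◅ τ-r ◅ ε , ε
τ-letR-↓ (c-letR τ-tt) = -, c-trM τ-letR ◅ τ-tt ◅ c-trQ τ-letlet ◅ c-trQ (c-letTL τ-tr) ◅ ε , τ-letR ◅ ε
τ-letR-↓ (c-letL st) = -, c-trM (c-letL st) ◅ ε , τ-letR ◅ ε
τ-letR-↓ τ-letL = ↓-sym (τ-letL-↓ τ-letR)

τ-ins-↓-same : ∀ {ϑ q M X} (i : Fin 9) → q ▷ M ⟶ₘ X →
               trT (replicate 9 r [ i ]≔ q) ▷ ins (ϑ [ i ]≔ M) ↓ₘ ins (ϑ [ i ]≔ X)
τ-ins-↓-same {ϑ} {q} {M} i (c-trQ {q' = q'} st) =
  join-≡ (c-trQ (c-trT (⟶ₜᵛ-at i (lookup-update-⇝ {_⇝_ = _⟶ₜ_} (replicate 9 r) i st))) ◅ ε)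
         (τ-ins i (lookup∘update i ϑ (q' ▷ M)) ◅ ε)
         (cong₂ (λ ζ ϑ' → trT ζ ▷ ins ϑ') ([]≔-idempotent (replicate 9 r) i) (sym ([]≔-idempotent ϑ i)))
τ-ins-↓-same {ϑ} {q} i (c-trM {M' = M'} st) =
  join-≡ (c-trM (c-ins (⟶ₘᵛ-at i (lookup-update-⇝ {_⇝_ = _⟶ₘ_} ϑ i st))) ◅ ε)
         (τ-ins i (lookup∘update i ϑ (q ▷ M')) ◅ ε)
         (cong (λ ϑ' → trT (replicate 9 r [ i ]≔ q) ▷ ins ϑ') ([]≔-overwritten ϑ i))
τ-ins-↓-same {ϑ} {M = M} i τ-r =
  -, subst (λ ζ → Star _⟶ₘ_ (trT ζ ▷ ins (ϑ [ i ]≔ M)) (ins (ϑ [ i ]≔ M))) (sym (replicate-r-update-r i))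
           (c-trQ τ-trr ◅ τ-r ◅ ε)
   , ε
τ-ins-↓-same {ϑ} {q} i (τ-tt {q' = q'} {M = M}) =
  join-≡ (c-trM (τ-ins i (lookup∘update i ϑ (q' ▷ M))) ◅ τ-tt ◅ c-trQ τ-trtr ◅
            c-trQ* (c-trT* (zipWith-t-update-update i q q')))
         (τ-ins i (lookup∘update i ϑ (t q q' ▷ M)) ◅ ε)
         (cong (λ ϑ' → trT (replicate 9 r [ i ]≔ t q q') ▷ ins ϑ') ([]≔-overwritten ϑ i))

τ-ins-↓ : ∀ {ϑ q M B} (i : Fin 9) → lookup ϑ i ≡ q ▷ M → ins ϑ ⟶ₘ B →
          trT (replicate 9 r [ i ]≔ q) ▷ ins (ϑ [ i ]≔ M) ↓ₘ B
τ-ins-↓ {ϑ} {q} {M} i eq (c-ins st) with ⟶ₘᵛ-position st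
... | j , X , stⱼ , refl with i ≟ᶠ j
...   | yes refl = τ-ins-↓-same i (subst (_⟶ₘ X) eq stⱼ)
...   | no i≢j =
  join-≡ (c-trM (c-ins (⟶ₘᵛ-at j (subst (_⟶ₘ X) (sym (lookup∘update′ (λ j≡i → i≢j (sym j≡i)) ϑ M)) stⱼ)))
            ◅ ε)
         (τ-ins i (trans (lookup∘update′ i≢j ϑ X) eq) ◅ ε)
         (cong (λ ϑ' → trT (replicate 9 r [ i ]≔ q) ▷ ins ϑ') ([]≔-commutes ϑ i j i≢j))
τ-ins-↓ i eq (τ-ins j eq') with i ≟ᶠ j
... | yes refl with trans (sym eq) eq'
...   | refl = -, ε , ε
τ-ins-↓ {ϑ} {q} {M} i eq (τ-ins {q = q'} {M = M'} j eq') | no i≢j =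
  join-≡ (c-trM (τ-ins j (trans (lookup∘update′ j≢i ϑ M) eq')) ◅ τ-tt ◅ c-trQ τ-trtr ◅
            c-trQ* (c-trT* (zipWith-t-update-update′ i j q q' i≢j)))
         (c-trM (τ-ins i (trans (lookup∘update′ i≢j ϑ M') eq)) ◅ τ-tt ◅ c-trQ τ-trtr ◅
            c-trQ* (c-trT* (zipWith-t-update-update′ j i q' q j≢i)))
         (cong₂ (λ ζ ϑ' → trT ζ ▷ ins ϑ') ([]≔-commutes (replicate 9 r) i j i≢j) ([]≔-commutes ϑ i j i≢j))
  where
  j≢i : ¬ j ≡ i
  j≢i j≡i = i≢j (sym j≡i)

wcrₘ : WeaklyConfluent _⟶ₘ_
wcrₜ : WeaklyConfluent _⟶ₜ_
wcrₛ : WeaklyConfluent _⟶ₛ_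
wcrₘᵛ : ∀ {n} → WeaklyConfluent (_⟶ₘᵛ_ {n})
wcrₜᵛ : ∀ {n} → WeaklyConfluent (_⟶ₜᵛ_ {n})

wcrₘ σ-id st = σ-id-↓ st
wcrₘ σ-cons st = σ-cons-↓ st
wcrₘ σ-lam st = σ-lam-↓ st
wcrₘ σ-app st = σ-app-↓ st
wcrₘ σ-bang st = σ-bang-↓ st
wcrₘ σ-let st = σ-let-↓ st
wcrₘ σ-tr st = σ-tr-↓ st
wcrₘ σ-ins st = σ-ins-↓ st
wcrₘ σ-clos st = σ-clos-↓ st
wcrₘ σ-er1 st = σ-er1-↓ st
wcrₘ σ-erups st = σ-erups-↓ st
wcrₘ σ-erlam st = σ-erlam-↓ st
wcrₘ σ-erapp st = σ-erapp-↓ st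
wcrₘ σ-erbang st = σ-erbang-↓ st
wcrₘ σ-erlet st = σ-erlet-↓ st
wcrₘ σ-ertr st = σ-ertr-↓ st
wcrₘ σ-erins st = σ-erins-↓ st
wcrₘ τ-r st = τ-r-↓ st
wcrₘ τ-tt st = τ-tt-↓ st
wcrₘ τ-bang st = τ-bang-↓ st
wcrₘ τ-lam st = τ-lam-↓ st
wcrₘ τ-appL st = τ-appL-↓ st
wcrₘ τ-appR st = τ-appR-↓ st
wcrₘ τ-letL st = τ-letL-↓ st
wcrₘ τ-letR st = τ-letR-↓ st
wcrₘ (τ-ins i eq) st = τ-ins-↓ i eq st
wcrₘ st σ-id = ↓-sym (σ-id-↓ st)
wcrₘ st σ-cons = ↓-sym (σ-cons-↓ st)
wcrₘ st σ-lam = ↓-sym (σ-lam-↓ st)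
wcrₘ st σ-app = ↓-sym (σ-app-↓ st)
wcrₘ st σ-bang = ↓-sym (σ-bang-↓ st)
wcrₘ st σ-let = ↓-sym (σ-let-↓ st)
wcrₘ st σ-tr = ↓-sym (σ-tr-↓ st)
wcrₘ st σ-ins = ↓-sym (σ-ins-↓ st)
wcrₘ st σ-clos = ↓-sym (σ-clos-↓ st)
wcrₘ st σ-er1 = ↓-sym (σ-er1-↓ st)
wcrₘ st σ-erups = ↓-sym (σ-erups-↓ st)
wcrₘ st σ-erlam = ↓-sym (σ-erlam-↓ st)
wcrₘ st σ-erapp = ↓-sym (σ-erapp-↓ st)
wcrₘ st σ-erbang = ↓-sym (σ-erbang-↓ st)
wcrₘ st σ-erlet = ↓-sym (σ-erlet-↓ st)
wcrₘ st σ-ertr = ↓-sym (σ-ertr-↓ st)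
wcrₘ st σ-erins = ↓-sym (σ-erins-↓ st)
wcrₘ st τ-r = ↓-sym (τ-r-↓ st)
wcrₘ st τ-tt = ↓-sym (τ-tt-↓ st)
wcrₘ st τ-bang = ↓-sym (τ-bang-↓ st)
wcrₘ st τ-lam = ↓-sym (τ-lam-↓ st)
wcrₘ st τ-appL = ↓-sym (τ-appL-↓ st)
wcrₘ st τ-appR = ↓-sym (τ-appR-↓ st)
wcrₘ st τ-letL = ↓-sym (τ-letL-↓ st)
wcrₘ st τ-letR = ↓-sym (τ-letR-↓ st)
wcrₘ st (τ-ins i eq) = ↓-sym (τ-ins-↓ i eq st)
wcrₘ (c-lam a) (c-lam b) = ↓-cong lam c-lam (wcrₘ a b)
wcrₘ (c-appL {N = N} a) (c-appL b) = ↓-cong (λ M → app M N) c-appL (wcrₘ a b)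
wcrₘ (c-appL a) (c-appR b) = -, c-appR b ◅ ε , c-appL a ◅ ε
wcrₘ (c-appR a) (c-appL b) = -, c-appL b ◅ ε , c-appR a ◅ ε
wcrₘ (c-appR {M = M} a) (c-appR b) = ↓-cong (app M) c-appR (wcrₘ a b)
wcrₘ (c-letL {N = N} a) (c-letL b) = ↓-cong (λ M → letₘ M N) c-letL (wcrₘ a b)
wcrₘ (c-letL a) (c-letR b) = -, c-letR b ◅ ε , c-letL a ◅ ε
wcrₘ (c-letR a) (c-letL b) = -, c-letL b ◅ ε , c-letR a ◅ ε
wcrₘ (c-letR {M = M} a) (c-letR b) = ↓-cong (letₘ M) c-letR (wcrₘ a b)
wcrₘ (c-bangQ {M = M} a) (c-bangQ b) = ↓-cong (λ q → bang q M) c-bangQ (wcrₜ a b)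
wcrₘ (c-bangQ a) (c-bangM b) = -, c-bangM b ◅ ε , c-bangQ a ◅ ε
wcrₘ (c-bangM a) (c-bangQ b) = -, c-bangQ b ◅ ε , c-bangM a ◅ ε
wcrₘ (c-bangM {q = q} a) (c-bangM b) = ↓-cong (bang q) c-bangM (wcrₘ a b)
wcrₘ (c-trQ {M = M} a) (c-trQ b) = ↓-cong (_▷ M) c-trQ (wcrₜ a b)
wcrₘ (c-trQ a) (c-trM b) = -, c-trM b ◅ ε , c-trQ a ◅ ε
wcrₘ (c-trM a) (c-trQ b) = -, c-trQ b ◅ ε , c-trM a ◅ ε
wcrₘ (c-trM {q = q} a) (c-trM b) = ↓-cong (q ▷_) c-trM (wcrₘ a b)
wcrₘ (c-ins a) (c-ins b) = ↓-cong ins c-ins (wcrₘᵛ a b)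
wcrₘ (c-clM {s = s} a) (c-clM b) = ↓-cong (_[ s ]) c-clM (wcrₘ a b)
wcrₘ (c-clM a) (c-clS b) = -, c-clS b ◅ ε , c-clM a ◅ ε
wcrₘ (c-clS a) (c-clM b) = -, c-clM b ◅ ε , c-clS a ◅ ε
wcrₘ (c-clS {M = M} a) (c-clS b) = ↓-cong (M [_]) c-clS (wcrₛ a b)
wcrₘ (c-er a) (c-er b) = ↓-cong er c-er (wcrₘ a b)

wcrₜ σ-tl1 st = σ-tl1-↓ st
wcrₜ σ-tlups st = σ-tlups-↓ st
wcrₜ σ-tllam st = σ-tllam-↓ st
wcrₜ σ-tlapp st = σ-tlapp-↓ st
wcrₜ σ-tlbang st = σ-tlbang-↓ st
wcrₜ σ-tllet st = σ-tllet-↓ st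
wcrₜ σ-tltr st = σ-tltr-↓ st
wcrₜ σ-tlins st = σ-tlins-↓ st
wcrₜ τ-tr st = τ-tr-↓ st
wcrₜ τ-rt st = τ-rt-↓ st
wcrₜ τ-trr st = τ-trr-↓ st
wcrₜ τ-apprr st = τ-apprr-↓ st
wcrₜ τ-lamr st = τ-lamr-↓ st
wcrₜ τ-letrr st = τ-letrr-↓ st
wcrₜ τ-assoc st = τ-assoc-↓ st
wcrₜ τ-lamlam st = τ-lamlam-↓ st
wcrₜ τ-lamlam' st = τ-lamlam'-↓ st
wcrₜ τ-appapp st = τ-appapp-↓ st
wcrₜ τ-appapp' st = τ-appapp'-↓ st
wcrₜ τ-letlet st = τ-letlet-↓ st
wcrₜ τ-letlet' st = τ-letlet'-↓ st
wcrₜ τ-trtr st = τ-trtr-↓ st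
wcrₜ τ-trtr' st = τ-trtr'-↓ st
wcrₜ st σ-tl1 = ↓-sym (σ-tl1-↓ st)
wcrₜ st σ-tlups = ↓-sym (σ-tlups-↓ st)
wcrₜ st σ-tllam = ↓-sym (σ-tllam-↓ st)
wcrₜ st σ-tlapp = ↓-sym (σ-tlapp-↓ st)
wcrₜ st σ-tlbang = ↓-sym (σ-tlbang-↓ st)
wcrₜ st σ-tllet = ↓-sym (σ-tllet-↓ st)
wcrₜ st σ-tltr = ↓-sym (σ-tltr-↓ st)
wcrₜ st σ-tlins = ↓-sym (σ-tlins-↓ st)
wcrₜ st τ-tr = ↓-sym (τ-tr-↓ st)
wcrₜ st τ-rt = ↓-sym (τ-rt-↓ st)
wcrₜ st τ-trr = ↓-sym (τ-trr-↓ st)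
wcrₜ st τ-apprr = ↓-sym (τ-apprr-↓ st)
wcrₜ st τ-lamr = ↓-sym (τ-lamr-↓ st)
wcrₜ st τ-letrr = ↓-sym (τ-letrr-↓ st)
wcrₜ st τ-assoc = ↓-sym (τ-assoc-↓ st)
wcrₜ st τ-lamlam = ↓-sym (τ-lamlam-↓ st)
wcrₜ st τ-lamlam' = ↓-sym (τ-lamlam'-↓ st)
wcrₜ st τ-appapp = ↓-sym (τ-appapp-↓ st)
wcrₜ st τ-appapp' = ↓-sym (τ-appapp'-↓ st)
wcrₜ st τ-letlet = ↓-sym (τ-letlet-↓ st)
wcrₜ st τ-letlet' = ↓-sym (τ-letlet'-↓ st)
wcrₜ st τ-trtr = ↓-sym (τ-trtr-↓ st)
wcrₜ st τ-trtr' = ↓-sym (τ-trtr'-↓ st)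
wcrₜ (c-tL {p = p} a) (c-tL b) = ↓-cong (λ q → t q p) c-tL (wcrₜ a b)
wcrₜ (c-tL a) (c-tR b) = -, c-tR b ◅ ε , c-tL a ◅ ε
wcrₜ (c-tR a) (c-tL b) = -, c-tL b ◅ ε , c-tR a ◅ ε
wcrₜ (c-tR {q = q} a) (c-tR b) = ↓-cong (t q) c-tR (wcrₜ a b)
wcrₜ (c-lamT a) (c-lamT b) = ↓-cong lamT c-lamT (wcrₜ a b)
wcrₜ (c-appTL {p = p} a) (c-appTL b) = ↓-cong (λ q → appT q p) c-appTL (wcrₜ a b)
wcrₜ (c-appTL a) (c-appTR b) = -, c-appTR b ◅ ε , c-appTL a ◅ ε
wcrₜ (c-appTR a) (c-appTL b) = -, c-appTL b ◅ ε , c-appTR a ◅ ε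
wcrₜ (c-appTR {q = q} a) (c-appTR b) = ↓-cong (appT q) c-appTR (wcrₜ a b)
wcrₜ (c-letTL {p = p} a) (c-letTL b) = ↓-cong (λ q → letT q p) c-letTL (wcrₜ a b)
wcrₜ (c-letTL a) (c-letTR b) = -, c-letTR b ◅ ε , c-letTL a ◅ ε
wcrₜ (c-letTR a) (c-letTL b) = -, c-letTL b ◅ ε , c-letTR a ◅ ε
wcrₜ (c-letTR {q = q} a) (c-letTR b) = ↓-cong (letT q) c-letTR (wcrₜ a b)
wcrₜ (c-trT a) (c-trT b) = ↓-cong trT c-trT (wcrₜᵛ a b)
wcrₜ (c-tl a) (c-tl b) = ↓-cong tl c-tl (wcrₘ a b)

wcrₛ σ-idl st = σ-idl-↓ st
wcrₛ σ-shid st = σ-shid-↓ st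
wcrₛ σ-shcons st = σ-shcons-↓ st
wcrₛ σ-map st = σ-map-↓ st
wcrₛ σ-assoc st = σ-assoc-↓ st
wcrₛ st σ-idl = ↓-sym (σ-idl-↓ st)
wcrₛ st σ-shid = ↓-sym (σ-shid-↓ st)
wcrₛ st σ-shcons = ↓-sym (σ-shcons-↓ st)
wcrₛ st σ-map = ↓-sym (σ-map-↓ st)
wcrₛ st σ-assoc = ↓-sym (σ-assoc-↓ st)
wcrₛ (c-consM {s = s} a) (c-consM b) = ↓-cong (_∷ₛ s) c-consM (wcrₘ a b)
wcrₛ (c-consM a) (c-consS b) = -, c-consS b ◅ ε , c-consM a ◅ ε
wcrₛ (c-consS a) (c-consM b) = -, c-consM b ◅ ε , c-consS a ◅ ε
wcrₛ (c-consS {M = M} a) (c-consS b) = ↓-cong (M ∷ₛ_) c-consS (wcrₛ a b)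
wcrₛ (c-compL {u = u} a) (c-compL b) = ↓-cong (_∘ₛ u) c-compL (wcrₛ a b)
wcrₛ (c-compL a) (c-compR b) = -, c-compR b ◅ ε , c-compL a ◅ ε
wcrₛ (c-compR a) (c-compL b) = -, c-compL b ◅ ε , c-compR a ◅ ε
wcrₛ (c-compR {s = s} a) (c-compR b) = ↓-cong (s ∘ₛ_) c-compR (wcrₛ a b)

wcrₘᵛ (here {ϑ = ϑ} a) (here b) = ↓-cong (_∷ ϑ) here (wcrₘ a b)
wcrₘᵛ (here a) (there b) = -, there b ◅ ε , here a ◅ ε
wcrₘᵛ (there a) (here b) = -, here b ◅ ε , there a ◅ ε
wcrₘᵛ (there {M = M} a) (there b) = ↓-cong (M ∷_) there (wcrₘᵛ a b)

wcrₜᵛ (here {ζ = ζ} a) (here b) = ↓-cong (_∷ ζ) here (wcrₜ a b)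
wcrₜᵛ (here a) (there b) = -, there b ◅ ε , here a ◅ ε
wcrₜᵛ (there a) (here b) = -, here b ◅ ε , there a ◅ ε
wcrₜᵛ (there {q = q} a) (there b) = ↓-cong (q ∷_) there (wcrₜᵛ a b)

plus-sn : ∀ {A : Set} {_⇝_ : A → A → Set} → StronglyNormalizing _⇝_ → StronglyNormalizing (⁺.Plus _⇝_)
plus-sn {_⇝_ = _⇝_} ⇝-sn = Subrelation.wellFounded reverse (⁺.wellFounded (flip _⇝_) ⇝-sn)
  where
  reverse : ∀ {x y} → ⁺.Plus _⇝_ y x → ⁺.TransClosure (flip _⇝_) x y
  reverse ⁺.[ y⇝x ] = ⁺.[ y⇝x ]
  reverse (_ ⁺.∼⁺⟨ y⇝⁺z ⟩ z⇝⁺x) = reverse z⇝⁺x ⁺.++ reverse y⇝⁺z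

theorem1 : (StronglyNormalizing _⟶ₘ_ × StronglyNormalizing _⟶ₜ_ × StronglyNormalizing _⟶ₛ_)
           × (Confluent _⟶ₘ_ × Confluent _⟶ₜ_ × Confluent _⟶ₛ_)
theorem1 = (⟶ₘ-sn , ⟶ₜ-sn , ⟶ₛ-sn)
         , (sn&wcr⇒cr (plus-sn ⟶ₘ-sn) wcrₘ , sn&wcr⇒cr (plus-sn ⟶ₜ-sn) wcrₜ , sn&wcr⇒cr (plus-sn ⟶ₛ-sn) wcrₛ)
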